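{- Let $H$ be a graph with $\ell:=\chi(H)\ge 2$. There is an integer $k_0$ (depending on $H$) such that for every integer $k'\ge k_0$ the following holds, where $k:=\ell k'$. Let $G_1$ be a complete $\ell$-partite graph of order $k|H|$ with vertex classes $U_1,\dots,U_\ell$ satisfying $|U_1|=\lfloor k|H|/\ell\rfloor+1$, $|U_2|=\lceil k|H|/\ell\rceil-1$ and $\lfloor k|H|/\ell\rfloor\le|U_i|\le\lceil k|H|/\ell\rceil$ for $i\ge 3$. Let $G_2$ be defined as follows: if ${\rm hcf}_c(H)=2$ and $k|H|$ is not divisible by $4$, $G_2$ is the disjoint union of two cliques of order $k|H|/2$; otherwise $G_2$ is the disjoint union of two cliques of orders $\lfloor k|H|/2\rfloor+1$ and $\lceil k|H|/2\rceil-1$. Then: if $\chi(H)\ge 3$, $G_1$ contains a perfect $H$-packing if and only if ${\rm hcf}(H)=1$; if $\chi(H)=2$, both $G_1$ and $G_2$ contain a perfect $H$-packing if and only if ${\rm hcf}(H)=1$.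
   Context: An optimal colouring of $H$ is a proper colouring using exactly $\chi(H)$ colours. For an optimal colouring $c$ with colour class sizes $x_1\le\dots\le x_\ell$, $\mathcal{D}(c):=\{x_{i+1}-x_i:1\le i\le\ell-1\}$; $\mathcal{D}(H)$ is the union of all $\mathcal{D}(c)$; ${\rm hcf}_\chi(H)$ is the highest common factor of the integers in $\mathcal{D}(H)$ (set to $\infty$ if $\mathcal{D}(H)=\{0\}$); ${\rm hcf}_c(H)$ is the highest common factor of the orders of the components of $H$. If $\chi(H)\ne 2$, ${\rm hcf}(H)=1$ means ${\rm hcf}_\chi(H)=1$; if $\chi(H)=2$, ${\rm hcf}(H)=1$ means ${\rm hcf}_c(H)=1$ and ${\rm hcf}_\chi(H)\le 2$. A perfect $H$-packing in $G$ is a collection of vertex-disjoint copies of $H$ covering all vertices of $G$. -}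

module Defs where

open import Data.Nat using (ℕ; zero; suc; _+_; _*_; _∸_; _≤_; _/_)
open import Data.Nat.Divisibility using (_∣_)
open import Data.Nat.Properties using (≤-decTotalOrder)
open import Data.Bool using (Bool; true; false; _∧_; _∨_; not; if_then_else_)
open import Data.Fin as Fin using (Fin; toℕ)
open import Data.Fin.Properties using (_≟_)
open import Data.List using (List; []; _∷_; length; filterᵇ; map; allFin)
open import Data.Bool.ListAction using (any)
open import Data.List.Membership.Propositional using (_∈_)
open import Data.List.Sort ≤-decTotalOrder using (sort)
open import Data.Nat.Base using (_<ᵇ_)
open import Data.Product using (Σ; _×_; _,_; ∃; ∃-syntax)
open import Relation.Nullary using (¬_; yes; no; Dec; does)
open import Relation.Binary.PropositionalEquality using (_≡_; _≢_; refl; cong; cong₂)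

record Graph : Set where
  field
    order  : ℕ
    adj    : Fin order → Fin order → Bool
    sym    : ∀ u v → adj u v ≡ adj v u
    irrefl : ∀ v → adj v v ≡ false
open Graph public

_==_ : ∀ {n} → Fin n → Fin n → Bool
x == y = does (x ≟ y)

==-refl : ∀ {n} (x : Fin n) → (x == x) ≡ true
==-refl x with x ≟ x
... | yes _ = refl
... | no ¬p with ¬p refl
... | ()

==-sym : ∀ {n} (x y : Fin n) → (x == y) ≡ (y == x)
==-sym x y with x ≟ y | y ≟ x
... | yes _ | yes _ = refl
... | no _ | no _ = refl
... | yes refl | no ¬q with ¬q refl
... | ()
==-sym x y | no ¬p | yes refl with ¬p refl
... | ()

count : ∀ {n} → (Fin n → Bool) → ℕ
count {n} P = length (filterᵇ P (allFin n))

ProperColouring : (H : Graph) (m : ℕ) → (Fin (order H) → Fin m) → Set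
ProperColouring H m c = ∀ u v → adj H u v ≡ true → c u ≢ c v

Colourable : Graph → ℕ → Set
Colourable H m = ∃[ c ] ProperColouring H m c

IsChromaticNumber : Graph → ℕ → Set
IsChromaticNumber H ℓ = Colourable H ℓ × (∀ m → Colourable H m → ℓ ≤ m)

classSizes : (H : Graph) (m : ℕ) → (Fin (order H) → Fin m) → List ℕ
classSizes H m c = map (λ j → count (λ v → c v == j)) (allFin m)

diffs : List ℕ → List ℕ
diffs [] = []
diffs (x ∷ []) = []
diffs (x ∷ y ∷ r) = (y ∸ x) ∷ diffs (y ∷ r)

Dc : (H : Graph) (m : ℕ) → (Fin (order H) → Fin m) → List ℕ
Dc H m c = diffs (sort (classSizes H m c))

-- d ∈ D(H), where ℓ is χ(H) (optimal colourings = proper colourings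
-- with ℓ colours)
InDH : (H : Graph) (ℓ : ℕ) → ℕ → Set
InDH H ℓ d = ∃[ c ] (ProperColouring H ℓ c × d ∈ Dc H ℓ c)

CommonDivD : Graph → ℕ → ℕ → Set
CommonDivD H ℓ g = ∀ d → InDH H ℓ d → g ∣ d

-- hcf_χ(H) = g (a finite value); hcf_χ(H) = ∞ iff no such g exists
HcfChi : (H : Graph) (ℓ : ℕ) (g : ℕ) → Set
HcfChi H ℓ g = CommonDivD H ℓ g × (∀ d → CommonDivD H ℓ d → d ≤ g)

reach : (H : Graph) → ℕ → Fin (order H) → Fin (order H) → Bool
reach H zero u v = u == v
reach H (suc k) u v =
  reach H k u v ∨ any (λ w → reach H k u w ∧ adj H w v) (allFin (order H))

compOrder : (H : Graph) → Fin (order H) → ℕ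
compOrder H v = count (reach H (order H) v)

CommonDivC : Graph → ℕ → Set
CommonDivC H g = ∀ v → g ∣ compOrder H v

HcfC : Graph → ℕ → Set
HcfC H g = CommonDivC H g × (∀ d → CommonDivC H d → d ≤ g)

HcfOne : Graph → ℕ → Set
HcfOne H ℓ = (ℓ ≢ 2 → HcfChi H ℓ 1)
           × (ℓ ≡ 2 → HcfC H 1 × (∃[ g ] (HcfChi H ℓ g × g ≤ 2)))

PerfectPacking : (H G : Graph) → Set
PerfectPacking H G =
  ∃[ t ] Σ (Fin t → Fin (order H) → Fin (order G)) λ φ →
               ((∀ (i : Fin t) x y → adj H x y ≡ true → adj G (φ i x) (φ i y) ≡ true)
               × (∀ i j x y → φ i x ≡ φ j y → (i ≡ j × x ≡ y))
               × (∀ v → ∃[ i ] ∃[ x ] (φ i x ≡ v)))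

multipartite : (N ℓ : ℕ) → (Fin N → Fin ℓ) → Graph
multipartite N ℓ p = record
  { order = N
  ; adj = λ u v → not (p u == p v)
  ; sym = λ u v → cong not (==-sym (p u) (p v))
  ; irrefl = λ v → cong not (==-refl (p v))
  }

classSize : ∀ {N ℓ} → (Fin N → Fin ℓ) → Fin ℓ → ℕ
classSize p i = count (λ v → p v == i)

-- division rounding down / up (divisor 0 is never used)
_⌊/⌋_ : ℕ → ℕ → ℕ
n ⌊/⌋ zero = 0
n ⌊/⌋ suc m = n / suc m

_⌈/⌉_ : ℕ → ℕ → ℕ
n ⌈/⌉ zero = 0
n ⌈/⌉ suc m = (n + m) / suc m

-- disjoint union of a clique on the first a vertices of Fin N and a
-- clique on the remaining N ∸ a vertices
side : ∀ {N} → ℕ → Fin N → Fin 2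
side a u = if toℕ u <ᵇ a then Fin.zero else Fin.suc Fin.zero

twoCliques-irrefl : ∀ N a (v : Fin N) → ((side a v == side a v) ∧ not (v == v)) ≡ false
twoCliques-irrefl N a v rewrite ==-refl (side a v) | ==-refl v = refl

twoCliques : (N a : ℕ) → Graph
twoCliques N a = record
  { order = N
  ; adj = λ u v → (side a u == side a v) ∧ not (u == v)
  ; sym = λ u v → cong₂ _∧_ (==-sym (side a u) (side a v)) (cong not (==-sym u v))
  ; irrefl = twoCliques-irrefl N a
  }

G1Classes : (N ℓ : ℕ) → (Fin N → Fin ℓ) → Set
G1Classes N ℓ p =
  ∃[ i₁ ] ∃[ i₂ ] (i₁ ≢ i₂
    × classSize p i₁ ≡ (N ⌊/⌋ ℓ) + 1
    × classSize p i₂ ≡ (N ⌈/⌉ ℓ) ∸ 1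
    × (∀ i → i ≢ i₁ → i ≢ i₂ → (N ⌊/⌋ ℓ ≤ classSize p i) × (classSize p i ≤ N ⌈/⌉ ℓ)))

G2Order : (H : Graph) (N a : ℕ) → Set
G2Order H N a =
  ((HcfC H 2 × ¬ (4 ∣ N)) → a ≡ N ⌊/⌋ 2)
  × (¬ (HcfC H 2 × ¬ (4 ∣ N)) → a ≡ (N ⌊/⌋ 2) + 1)

-- A perfect H-packing of a complete multipartite graph, or of two disjoint cliques, amounts to a
-- family of colourings of H (proper colourings, resp. 2-colourings constant on components) whose
-- class sizes add up to the class sizes of the host graph.
--
-- Necessity: the class sizes of an optimal colouring are congruent modulo hcf_χ(H), and the classes
-- of a colouring constant on components have sizes divisible by hcf_c(H). Summing over the copies,
-- the class sizes k′|H| + 1, k′|H| - 1 (and k′|H|) of G₁ and the clique orders of G₂ force hcf(H) = 1.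
--
-- Sufficiency: call two admissible colourings an exchange of amount d if, in class sizes, one
-- arises from the other by moving d vertices between two colours. If hcf(H) = 1, the finitely many
-- exchange amounts have gcd 1 (for χ(H) = 2, flipping the colours on an odd component gives an odd
-- amount), so by Bézout some exchanges have total amount one more than some others. The ℓ cyclic
-- shifts of the colours of a colouring use every colour |H| times; replacing one shift by the other
-- side of an exchange moves its amount between two prescribed colours. Such blocks, combined along
-- the Bézout relation and padded with plain shifts, realise the class sizes of G₁ and G₂ as soon as
-- k′ exceeds the number of blocks.

module Submission where

open import Defs hiding (sym)
open import Axiom.UniquenessOfIdentityProofs using (module Decidable⇒UIP)
open import Data.Bool using (Bool; true; false; _∧_; _∨_; not; if_then_else_)
open import Data.Bool.ListAction using (any)
open import Data.Bool.Properties using (T-≡; T-∧; ∨-zeroʳ; ∧-zeroʳ; ¬-not) renaming (_≟_ to _≟ᵇ_)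
open import Data.Fin using (Fin; zero; suc; toℕ; fromℕ<; splitAt; _↑ˡ_; _↑ʳ_; opposite)
open import Data.Fin.Permutation using (Permutation′; _⟨$⟩ʳ_; _⟨$⟩ˡ_; inverseˡ; inverseʳ; transpose; _∘ₚ_)
  renaming (id to idₚ)
open import Data.Fin.Properties using (_≟_; all?; any?; ¬∀⟶∃¬; toℕ<n; toℕ-fromℕ<; toℕ-injective; injective⇒≤;
  splitAt-↑ˡ; splitAt-↑ʳ; splitAt⁻¹-↑ˡ; splitAt⁻¹-↑ʳ; opposite-involutive)
import Data.Fin.Properties as Finₚ
open import Data.List using (List; []; _∷_; _++_; length; map; concat; replicate; concatMap; filterᵇ;
  tabulate; allFin; lookup; foldr)
open import Data.List.Membership.Propositional using (_∈_)
open import Data.List.Membership.Propositional.Properties using (∈-concatMap⁺; ∈-map⁺; ∈-map⁻; ∈-allFin; ∈-lookup)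
open import Data.List.Properties using (length-filter; length-tabulate; map-++)
open import Data.List.Relation.Binary.Permutation.Propositional using (↭-sym)
open import Data.List.Relation.Binary.Permutation.Propositional.Properties using (∈-resp-↭; ↭-length)
open import Data.List.Relation.Unary.All as All using (All; []; _∷_)
open import Data.List.Relation.Unary.All.Properties using (++⁺)
open import Data.List.Relation.Unary.Any as Any using (here; there)
open import Data.List.Relation.Unary.Any.Properties using (any⁺; any⁻; tabulate⁺; tabulate⁻)
open import Data.List.Relation.Unary.Linked using (Linked; []; _∷_)
open import Data.Nat using (ℕ; zero; suc; _+_; _*_; _∸_; _/_; _≤_; _<_; _≤?_; _<ᵇ_; z≤n; s≤s; NonZero)
open import Data.Nat.DivMod using (_%_; _mod_; %-distribˡ-+; [m+n]%n≡m%n; m<n⇒m%n≡m; m*n/n≡m; +-distrib-/-∣ˡ;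
  m<n⇒m/n≡0)
open import Data.Nat.Divisibility using (_∣_; divides; _∣?_; ∣-trans; ∣⇒≤; ∣1⇒≡1; 0∣⇒≡0; ∣m+n∣m⇒∣n;
  ∣m∣n⇒∣m+n; 1∣_)
open import Data.Nat.GCD using (gcd; gcd[m,n]∣m; gcd[m,n]∣n; gcd-GCD; module Bézout)
open import Data.Nat.ListAction using (sum)
open import Data.Nat.ListAction.Properties using (sum-++; sum-↭)
open import Data.Nat.Properties hiding (_≟_)
import Data.Nat.Properties as ℕ
open import Data.Nat.Tactic.RingSolver using (solve-∀)
open import Algebra.Properties.CommutativeMonoid.Sum +-0-commutativeMonoid
  using (sum-syntax; sum-cong-≗; ∑-distrib-+; ∑-comm; sum-replicate-zero)
open import Data.List.Sort ≤-decTotalOrder using (sort; sort-↭; sort-↗)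
open import Data.Product using (Σ; Σ-syntax; _×_; _,_; proj₁; proj₂; ∃-syntax)
open import Data.Product.Properties using (,-injectiveʳ-UIP; ,-injective)
open import Data.Sum using (_⊎_; inj₁; inj₂; [_,_])
open import Data.Unit using (⊤; tt)
import Data.Vec.Functional as Vector
open import Function using (_∘_; id)
open import Function.Bundles using (_↔_; _⇔_; Inverse; Equivalence; mk↔ₛ′; mk⇔)
open import Function.Definitions using (Injective)
open import Relation.Binary.PropositionalEquality hiding ([_])
open import Relation.Nullary using (Dec; yes; no; ¬_; ¬?; _×-dec_; _→-dec_)
open import Relation.Nullary.Decidable using (T?; dec-true; dec-false; decidable-stable)
open import Relation.Nullary.Negation using (contradiction)

⟦_⟧ : Bool → ℕ
⟦ true ⟧ = 1
⟦ false ⟧ = 0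

==⇒≡ : ∀ {n} {x y : Fin n} → (x == y) ≡ true → x ≡ y
==⇒≡ {x = x} {y} eq with x ≟ y
... | yes x≡y = x≡y

≡⇒== : ∀ {n} {x y : Fin n} → x ≡ y → (x == y) ≡ true
≡⇒== {x = x} {y} = dec-true (x ≟ y)

≢⇒== : ∀ {n} {x y : Fin n} → x ≢ y → (x == y) ≡ false
≢⇒== {x = x} {y} = dec-false (x ≟ y)

length-filterᵇ-tabulate : ∀ {A : Set} {n} (P : A → Bool) (g : Fin n → A) →
  length (filterᵇ P (tabulate g)) ≡ ∑[ i < n ] ⟦ P (g i) ⟧
length-filterᵇ-tabulate {n = zero} P g = refl
length-filterᵇ-tabulate {n = suc n} P g with P (g zero)
... | true = cong suc (length-filterᵇ-tabulate P (g ∘ suc))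
... | false = length-filterᵇ-tabulate P (g ∘ suc)

count-sum : ∀ {n} (P : Fin n → Bool) → count P ≡ ∑[ i < n ] ⟦ P i ⟧
count-sum P = length-filterᵇ-tabulate P id

count-cong : ∀ {n} {P Q : Fin n → Bool} → P ≗ Q → count P ≡ count Q
count-cong {P = P} {Q} P≗Q = begin
  count P            ≡⟨ count-sum P ⟩
  ∑[ i < _ ] ⟦ P i ⟧  ≡⟨ sum-cong-≗ (cong ⟦_⟧ ∘ P≗Q) ⟩
  ∑[ i < _ ] ⟦ Q i ⟧  ≡⟨ count-sum Q ⟨
  count Q            ∎
  where open ≡-Reasoning

∑-zero : ∀ {n} (f : Fin n → ℕ) → (∀ i → f i ≡ 0) → ∑[ i < n ] f i ≡ 0
∑-zero {n} f f≗0 = trans (sum-cong-≗ f≗0) (sum-replicate-zero n)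

∑-const : ∀ n c → ∑[ i < n ] c ≡ n * c
∑-const zero c = refl
∑-const (suc n) c = cong (c +_) (∑-const n c)

∑-mono-≤ : ∀ {n} {f g : Fin n → ℕ} → (∀ i → f i ≤ g i) → ∑[ i < n ] f i ≤ ∑[ i < n ] g i
∑-mono-≤ {zero} f≤g = z≤n
∑-mono-≤ {suc n} f≤g = +-mono-≤ (f≤g zero) (∑-mono-≤ (f≤g ∘ suc))

∑-mono-< : ∀ {n} {f g : Fin n → ℕ} → (∀ i → f i ≤ g i) → ∀ j → f j < g j →
  ∑[ i < n ] f i < ∑[ i < n ] g i
∑-mono-< f≤g zero fj<gj = +-mono-<-≤ fj<gj (∑-mono-≤ (f≤g ∘ suc))
∑-mono-< f≤g (suc j) fj<gj = +-mono-≤-< (f≤g zero) (∑-mono-< (f≤g ∘ suc) j fj<gj)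

∑-unique : ∀ {n} (P : Fin n → Bool) (w : Fin n) → P w ≡ true → (∀ i → P i ≡ true → i ≡ w) →
  ∑[ i < n ] ⟦ P i ⟧ ≡ 1
∑-unique P zero Pw uniq = cong₂ _+_ (cong ⟦_⟧ Pw)
  (∑-zero _ (λ i → cong ⟦_⟧ (¬-not (λ Psi → Finₚ.0≢1+n (sym (uniq (suc i) Psi))))))
∑-unique P (suc w) Pw uniq = cong₂ _+_
  (cong ⟦_⟧ (¬-not (λ P0 → Finₚ.0≢1+n (uniq zero P0))))
  (∑-unique (P ∘ suc) w Pw (λ i Psi → Finₚ.suc-injective (uniq (suc i) Psi)))

count≤ : ∀ {n} (P : Fin n → Bool) → count P ≤ n
count≤ {n} P = ≤-trans (length-filter (T? ∘ P) (allFin n)) (≤-reflexive (length-tabulate id))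

count-false : ∀ {n} (P : Fin n → Bool) → (∀ i → P i ≡ false) → count P ≡ 0
count-false P P≡false = trans (count-sum P) (∑-zero _ (cong ⟦_⟧ ∘ P≡false))

count-< : ∀ {n} (P Q : Fin n → Bool) → (∀ i → P i ≡ true → Q i ≡ true) →
  ∀ j → P j ≡ false → Q j ≡ true → count P < count Q
count-< P Q P⊆Q j Pj Qj = subst₂ _<_ (sym (count-sum P)) (sym (count-sum Q))
  (∑-mono-< ⟦P⟧≤⟦Q⟧ j (subst₂ (λ p q → ⟦ p ⟧ < ⟦ q ⟧) (sym Pj) (sym Qj) (s≤s z≤n)))
  where
  ⟦P⟧≤⟦Q⟧ : ∀ i → ⟦ P i ⟧ ≤ ⟦ Q i ⟧
  ⟦P⟧≤⟦Q⟧ i with P i in Pi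
  ... | true rewrite P⊆Q i Pi = s≤s z≤n
  ... | false = z≤n

count-∧-split : ∀ {n} (P Q : Fin n → Bool) →
  count P ≡ count (λ i → P i ∧ Q i) + count (λ i → P i ∧ not (Q i))
count-∧-split P Q = begin
  count P
    ≡⟨ count-sum P ⟩
  ∑[ i < _ ] ⟦ P i ⟧
    ≡⟨ sum-cong-≗ (λ i → split (P i) (Q i)) ⟩
  ∑[ i < _ ] (⟦ P i ∧ Q i ⟧ + ⟦ P i ∧ not (Q i) ⟧)
    ≡⟨ ∑-distrib-+ (λ i → ⟦ P i ∧ Q i ⟧) (λ i → ⟦ P i ∧ not (Q i) ⟧) ⟩
  ∑[ i < _ ] ⟦ P i ∧ Q i ⟧ + ∑[ i < _ ] ⟦ P i ∧ not (Q i) ⟧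
    ≡⟨ cong₂ _+_ (count-sum (λ i → P i ∧ Q i)) (count-sum (λ i → P i ∧ not (Q i))) ⟨
  count (λ i → P i ∧ Q i) + count (λ i → P i ∧ not (Q i)) ∎
  where
  open ≡-Reasoning
  split : ∀ p q → ⟦ p ⟧ ≡ ⟦ p ∧ q ⟧ + ⟦ p ∧ not q ⟧
  split true true = refl
  split true false = refl
  split false q = refl

∑-classSize : ∀ {h m} (c : Fin h → Fin m) → ∑[ z < m ] classSize c z ≡ h
∑-classSize {h} {m} c = begin
  ∑[ z < m ] classSize c z                ≡⟨ sum-cong-≗ (λ z → count-sum (λ x → c x == z)) ⟩
  ∑[ z < m ] ∑[ x < h ] ⟦ c x == z ⟧      ≡⟨ ∑-comm (λ z x → ⟦ c x == z ⟧) ⟩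
  ∑[ x < h ] ∑[ z < m ] ⟦ c x == z ⟧      ≡⟨ sum-cong-≗ (λ x → ∑-unique _ (c x) (==-refl (c x)) (λ z eq → sym (==⇒≡ eq))) ⟩
  ∑[ x < h ] 1                            ≡⟨ ∑-const h 1 ⟩
  h * 1                                   ≡⟨ *-identityʳ h ⟩
  h                                       ∎
  where open ≡-Reasoning

2∣n+n : ∀ n → 2 ∣ n + n
2∣n+n n = divides n (trans (cong (n +_) (sym (+-identityʳ n))) (*-comm 2 n))

M+1≡M∸1+2 : ∀ {M} → 1 ≤ M → M + 1 ≡ M ∸ 1 + 2
M+1≡M∸1+2 {M} M≥1 = trans (cong (_+ 1) (sym (m∸n+n≡m M≥1))) (+-assoc (M ∸ 1) 1 1)

∣-∑ : ∀ {d n} (f : Fin n → ℕ) → (∀ j → d ∣ f j) → d ∣ ∑[ j < n ] f j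
∣-∑ {n = zero} f d∣f = divides 0 refl
∣-∑ {n = suc n} f d∣f = ∣m∣n⇒∣m+n (d∣f zero) (∣-∑ (f ∘ suc) (d∣f ∘ suc))

infix 4 _≡_[mod_]

_≡_[mod_] : ℕ → ℕ → ℕ → Set
x ≡ y [mod g ] = ∃[ u ] ∃[ v ] x + u * g ≡ y + v * g

module _ {g : ℕ} where

  mod-refl : ∀ {x} → x ≡ x [mod g ]
  mod-refl = 0 , 0 , refl

  mod-sym : ∀ {x y} → x ≡ y [mod g ] → y ≡ x [mod g ]
  mod-sym (u , v , eq) = v , u , sym eq

  mod-+ : ∀ {x₁ y₁ x₂ y₂} → x₁ ≡ y₁ [mod g ] → x₂ ≡ y₂ [mod g ] → x₁ + x₂ ≡ y₁ + y₂ [mod g ]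
  mod-+ {x₁} {y₁} {x₂} {y₂} (u₁ , v₁ , eq₁) (u₂ , v₂ , eq₂) = u₁ + u₂ , v₁ + v₂ , (begin
    x₁ + x₂ + (u₁ + u₂) * g          ≡⟨ regroup x₁ x₂ u₁ u₂ g ⟩
    (x₁ + u₁ * g) + (x₂ + u₂ * g)    ≡⟨ cong₂ _+_ eq₁ eq₂ ⟩
    (y₁ + v₁ * g) + (y₂ + v₂ * g)    ≡⟨ regroup y₁ y₂ v₁ v₂ g ⟨
    y₁ + y₂ + (v₁ + v₂) * g          ∎)
    where
    open ≡-Reasoning
    regroup : ∀ x₁ x₂ u₁ u₂ g → x₁ + x₂ + (u₁ + u₂) * g ≡ (x₁ + u₁ * g) + (x₂ + u₂ * g)
    regroup = solve-∀

  mod-trans : ∀ {x y z} → x ≡ y [mod g ] → y ≡ z [mod g ] → x ≡ z [mod g ]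
  mod-trans {x} {y} {z} (u , v , eq) (u′ , v′ , eq′) = u + u′ , v′ + v , +-cancelˡ-≡ y _ _ (begin
    y + (x + (u + u′) * g)           ≡⟨ regroup y x u u′ g ⟩
    (x + u * g) + (y + u′ * g)       ≡⟨ cong₂ _+_ eq eq′ ⟩
    (y + v * g) + (z + v′ * g)       ≡⟨ regroup′ y v z v′ g ⟩
    y + (z + (v′ + v) * g)           ∎)
    where
    open ≡-Reasoning
    regroup : ∀ y x u u′ g → y + (x + (u + u′) * g) ≡ (x + u * g) + (y + u′ * g)
    regroup = solve-∀
    regroup′ : ∀ y v z v′ g → (y + v * g) + (z + v′ * g) ≡ y + (z + (v′ + v) * g)
    regroup′ = solve-∀

  mod-∑ : ∀ {n} (f f′ : Fin n → ℕ) → (∀ j → f j ≡ f′ j [mod g ]) → ∑[ j < n ] f j ≡ ∑[ j < n ] f′ j [mod g ]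
  mod-∑ {zero} f f′ f≡f′ = mod-refl
  mod-∑ {suc n} f f′ f≡f′ = mod-+ (f≡f′ zero) (mod-∑ (f ∘ suc) (f′ ∘ suc) (f≡f′ ∘ suc))

  ∣⇒+-mod : ∀ {x d} → g ∣ d → x + d ≡ x [mod g ]
  ∣⇒+-mod {x} (divides q refl) = 0 , q , +-identityʳ _

  +-mod⇒∣ : ∀ {x e} → x + e ≡ x [mod g ] → g ∣ e
  +-mod⇒∣ {x} {e} (u , v , eq) = divides (v ∸ u) (begin
    e                      ≡⟨ m+n∸n≡m e (u * g) ⟨
    e + u * g ∸ u * g      ≡⟨ cong (_∸ u * g) (+-cancelˡ-≡ x _ _ (trans (sym (+-assoc x e (u * g))) eq)) ⟩
    v * g ∸ u * g          ≡⟨ *-distribʳ-∸ g v u ⟨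
    (v ∸ u) * g            ∎)
    where open ≡-Reasoning

diffs-∈ : ∀ {d} xs → Linked _≤_ xs → d ∈ diffs xs → ∃[ x ] ∃[ y ] (x ∈ xs × y ∈ xs × d + x ≡ y)
diffs-∈ (x ∷ y ∷ xs) (x≤y ∷ _) (here refl) = x , y , here refl , there (here refl) , m∸n+n≡m x≤y
diffs-∈ (x ∷ y ∷ xs) (_ ∷ sorted) (there d∈) with diffs-∈ (y ∷ xs) sorted d∈
... | a , b , a∈ , b∈ , eq = a , b , there a∈ , there b∈ , eq

sorted-mod-head : ∀ {g} x₀ xs → Linked _≤_ (x₀ ∷ xs) → (∀ {d} → d ∈ diffs (x₀ ∷ xs) → g ∣ d) →
  ∀ {x} → x ∈ x₀ ∷ xs → x ≡ x₀ [mod g ]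
sorted-mod-head x₀ xs sorted g∣diffs (here refl) = mod-refl
sorted-mod-head x₀ (y ∷ xs) (x₀≤y ∷ sorted) g∣diffs (there x∈) =
  mod-trans (sorted-mod-head y xs sorted (g∣diffs ∘ there) x∈)
            (subst (λ z → z ≡ x₀ [mod _ ]) (m+[n∸m]≡n x₀≤y) (∣⇒+-mod (g∣diffs (here refl))))

sorted-mod : ∀ {g} xs → Linked _≤_ xs → (∀ {d} → d ∈ diffs xs → g ∣ d) →
  ∀ {x y} → x ∈ xs → y ∈ xs → x ≡ y [mod g ]
sorted-mod (x₀ ∷ xs) sorted g∣diffs x∈ y∈ =
  mod-trans (sorted-mod-head x₀ xs sorted g∣diffs x∈) (mod-sym (sorted-mod-head x₀ xs sorted g∣diffs y∈))

module _ {W : Set} (val : W → ℕ) where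

  Σval : List W → ℕ
  Σval ws = sum (map val ws)

  Σval-++ : ∀ xs ys → Σval (xs ++ ys) ≡ Σval xs + Σval ys
  Σval-++ xs ys = trans (cong sum (map-++ val xs ys)) (sum-++ (map val xs) (map val ys))

  Σval-replicate : ∀ n w → Σval (replicate n w) ≡ n * val w
  Σval-replicate zero w = refl
  Σval-replicate (suc n) w = cong (val w +_) (Σval-replicate n w)

  Σval-repeat : ∀ n xs → Σval (concat (replicate n xs)) ≡ n * Σval xs
  Σval-repeat zero xs = refl
  Σval-repeat (suc n) xs = trans (Σval-++ xs _) (cong (Σval xs +_) (Σval-repeat n xs))

  gcdᴸ : List W → ℕ
  gcdᴸ = foldr (λ w g → gcd (val w) g) 0

  gcdᴸ-∣ : ∀ {ws w} → w ∈ ws → gcdᴸ ws ∣ val w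
  gcdᴸ-∣ {w ∷ ws} (here refl) = gcd[m,n]∣m (val w) (gcdᴸ ws)
  gcdᴸ-∣ {w′ ∷ ws} (there w∈ws) = ∣-trans (gcd[m,n]∣n (val w′) (gcdᴸ ws)) (gcdᴸ-∣ w∈ws)

  gcdᴸ≡1 : ∀ ws → (∀ d → (∀ {w} → w ∈ ws → d ∣ val w) → d ≤ 1) → gcdᴸ ws ≡ 1
  gcdᴸ≡1 ws coprime with gcdᴸ ws in g≡ | coprime (gcdᴸ ws) gcdᴸ-∣
  ... | 1 | _ = refl
  ... | suc (suc _) | s≤s ()
  ... | zero | _ = contradiction (coprime 2 2∣values) (<⇒≱ (s≤s (s≤s z≤n)))
    where
    2∣values : ∀ {w} → w ∈ ws → 2 ∣ val w
    2∣values w∈ws = subst (2 ∣_) (sym (0∣⇒≡0 (subst (_∣ _) g≡ (gcdᴸ-∣ w∈ws)))) (divides 0 refl)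

  -- the Bézout coefficients are realised as repetitions of list elements
  bézoutᴸ : ∀ ws → Σ[ P ∈ List W ] Σ[ M ∈ List W ] Σval P ≡ gcdᴸ ws + Σval M
  bézoutᴸ [] = [] , [] , refl
  bézoutᴸ (w ∷ ws) with bézoutᴸ ws | Bézout.identity (gcd-GCD (val w) (gcdᴸ ws))
  ... | P , M , ΣP≡g+ΣM | Bézout.+- x y g′+yg≡xv =
    replicate x w ++ concat (replicate y M) , concat (replicate y P) , (begin
      Σval (replicate x w ++ concat (replicate y M))               ≡⟨ Σval-++ (replicate x w) _ ⟩
      Σval (replicate x w) + Σval (concat (replicate y M))         ≡⟨ cong₂ _+_ (Σval-replicate x w) (Σval-repeat y M) ⟩
      x * val w + y * Σval M                                       ≡⟨ cong (_+ y * Σval M) g′+yg≡xv ⟨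
      g′ + y * g + y * Σval M                                      ≡⟨ regroup g′ g y (Σval M) ⟩
      g′ + y * (g + Σval M)                                        ≡⟨ cong (λ s → g′ + y * s) ΣP≡g+ΣM ⟨
      g′ + y * Σval P                                              ≡⟨ cong (g′ +_) (Σval-repeat y P) ⟨
      g′ + Σval (concat (replicate y P))                           ∎)
    where
    open ≡-Reasoning
    g g′ : ℕ
    g = gcdᴸ ws
    g′ = gcd (val w) g
    regroup : ∀ g′ g y m → g′ + y * g + y * m ≡ g′ + y * (g + m)
    regroup = solve-∀
  ... | P , M , ΣP≡g+ΣM | Bézout.-+ x y g′+xv≡yg =
    concat (replicate y P) , concat (replicate y M) ++ replicate x w , (begin
      Σval (concat (replicate y P))                                ≡⟨ Σval-repeat y P ⟩
      y * Σval P                                                   ≡⟨ cong (y *_) ΣP≡g+ΣM ⟩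
      y * (g + Σval M)                                             ≡⟨ *-distribˡ-+ y g (Σval M) ⟩
      y * g + y * Σval M                                           ≡⟨ cong (_+ y * Σval M) g′+xv≡yg ⟨
      g′ + x * val w + y * Σval M                                  ≡⟨ regroup g′ (x * val w) (y * Σval M) ⟩
      g′ + (y * Σval M + x * val w)
        ≡⟨ cong (g′ +_) (cong₂ _+_ (Σval-repeat y M) (Σval-replicate x w)) ⟨
      g′ + (Σval (concat (replicate y M)) + Σval (replicate x w))  ≡⟨ cong (g′ +_) (Σval-++ (concat (replicate y M)) _) ⟨
      g′ + Σval (concat (replicate y M) ++ replicate x w)          ∎)
    where
    open ≡-Reasoning
    g g′ : ℕ
    g = gcdᴸ ws
    g′ = gcd (val w) g
    regroup : ∀ g′ a b → g′ + a + b ≡ g′ + (b + a)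
    regroup = solve-∀

functions : ∀ h m → List (Fin h → Fin m)
functions zero m = (λ ()) ∷ []
functions (suc h) m = concatMap (λ v → map (v Vector.∷_) (functions h m)) (allFin m)

∈-concatMap⁺′ : ∀ {A B : Set} {f : A → List B} {x xs y} → x ∈ xs → y ∈ f x → y ∈ concatMap f xs
∈-concatMap⁺′ {f = f} x∈xs y∈fx = ∈-concatMap⁺ f (Any.map (λ { refl → y∈fx }) x∈xs)

functions-complete : ∀ {h m} (f : Fin h → Fin m) → ∃[ g ] (g ∈ functions h m × g ≗ f)
functions-complete {zero} f = (λ ()) , here refl , λ ()
functions-complete {suc h} f with functions-complete (f ∘ suc)
... | g , g∈ , g≗ = f zero Vector.∷ g , ∈-concatMap⁺′ (∈-allFin (f zero)) (∈-map⁺ (f zero Vector.∷_) g∈) , cons≗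
  where
  cons≗ : (f zero Vector.∷ g) ≗ f
  cons≗ zero = refl
  cons≗ (suc x) = g≗ x

-- Perfect packings as families of colourings

-- An enumeration of every fibre cl⁻¹(z) by Fin (c z).
record FibreSizes {A : Set} {m : ℕ} (cl : A → Fin m) (c : Fin m → ℕ) : Set where
  field
    to : A → Σ (Fin m) (Fin ∘ c)
    from : Σ (Fin m) (Fin ∘ c) → A
    from-to : ∀ a → from (to a) ≡ a
    to-from : ∀ w → to (from w) ≡ w
    proj₁-to : ∀ a → proj₁ (to a) ≡ cl a
open FibreSizes

module _ {m : ℕ} where

  fibres-↔ : ∀ {A B : Set} {cl : B → Fin m} {c : Fin m → ℕ} (e : A ↔ B) →
    FibreSizes cl c → FibreSizes (cl ∘ Inverse.to e) c
  fibres-↔ e F = record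
    { to = to F ∘ Inverse.to e
    ; from = Inverse.from e ∘ from F
    ; from-to = λ a → trans (cong (Inverse.from e) (from-to F _)) (Inverse.strictlyInverseʳ e a)
    ; to-from = λ w → trans (cong (to F) (Inverse.strictlyInverseˡ e _)) (to-from F w)
    ; proj₁-to = proj₁-to F ∘ Inverse.to e
    }

  fibres-cong : ∀ {A : Set} {cl cl′ : A → Fin m} {c c′ : Fin m → ℕ} →
    cl ≗ cl′ → c ≗ c′ → FibreSizes cl c → FibreSizes cl′ c′
  fibres-cong {A} {cl} {cl′} {c} {c′} cl≗cl′ c≗c′ F = record
    { to = to′
    ; from = from′
    ; from-to = from-to′
    ; to-from = to-from′
    ; proj₁-to = λ a → trans (proj₁-to F a) (cl≗cl′ a)
    }
    where
    to′ : A → Σ (Fin m) (Fin ∘ c′)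
    to′ a = proj₁ (to F a) , subst Fin (c≗c′ _) (proj₂ (to F a))
    from′ : Σ (Fin m) (Fin ∘ c′) → A
    from′ (z , k) = from F (z , subst Fin (sym (c≗c′ z)) k)
    from-to′ : ∀ a → from′ (to′ a) ≡ a
    from-to′ a with to F a | from-to F a
    ... | z , k | eq rewrite subst-sym-subst {P = Fin} (c≗c′ z) {k} = eq
    to-from′ : ∀ w → to′ (from′ w) ≡ w
    to-from′ (z , k) rewrite to-from F (z , subst Fin (sym (c≗c′ z)) k)
                           | subst-subst-sym {P = Fin} (c≗c′ z) {k} = refl

  fibres-⊥ : ∀ {A : Set} {cl : A → Fin m} → (A → Fin 0) → FibreSizes cl (λ _ → 0)
  fibres-⊥ empty = record
    { to = λ a → contradiction (empty a) λ ()
    ; from = λ ()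
    ; from-to = λ a → contradiction (empty a) λ ()
    ; to-from = λ ()
    ; proj₁-to = λ a → contradiction (empty a) λ ()
    }

  fibres-point : (z₀ : Fin m) {c : Fin m → ℕ} → c z₀ ≡ 1 → (∀ z → z₀ ≢ z → c z ≡ 0) →
    FibreSizes {⊤} (λ _ → z₀) c
  fibres-point z₀ {c} c[z₀]≡1 c≡0 = record
    { to = λ _ → z₀ , subst Fin (sym c[z₀]≡1) zero
    ; from = λ _ → tt
    ; from-to = λ _ → refl
    ; to-from = to-from′
    ; proj₁-to = λ _ → refl
    }
    where
    Fin1-unique : (k : Fin 1) → zero ≡ k
    Fin1-unique zero = refl
    to-from′ : ∀ w → (z₀ , subst Fin (sym c[z₀]≡1) zero) ≡ w
    to-from′ (z , k) with z₀ ≟ z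
    ... | yes refl = cong (z₀ ,_) (trans (cong (subst Fin (sym c[z₀]≡1)) (Fin1-unique (subst Fin c[z₀]≡1 k)))
                                         (subst-sym-subst {P = Fin} c[z₀]≡1))
    ... | no z₀≢z = contradiction (subst Fin (c≡0 z z₀≢z) k) λ ()

  fibres-singleton : (z₀ : Fin m) → FibreSizes {⊤} (λ _ → z₀) (λ z → ⟦ z₀ == z ⟧)
  fibres-singleton z₀ = fibres-point z₀ (cong ⟦_⟧ (==-refl z₀)) (λ z → cong ⟦_⟧ ∘ ≢⇒==)

  fibres-⊎ : ∀ {A B : Set} {clA : A → Fin m} {clB : B → Fin m} {a b : Fin m → ℕ} →
    FibreSizes clA a → FibreSizes clB b → FibreSizes [ clA , clB ] (λ z → a z + b z)
  fibres-⊎ {A} {B} {clA} {clB} {a} {b} FA FB = record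
    { to = to′ ; from = from′ ; from-to = from-to′ ; to-from = to-from′ ; proj₁-to = proj₁-to′ }
    where
    to′ : A ⊎ B → Σ (Fin m) (λ z → Fin (a z + b z))
    to′ (inj₁ x) = let (z , k) = to FA x in z , k ↑ˡ b z
    to′ (inj₂ y) = let (z , k) = to FB y in z , a z ↑ʳ k
    from-split : (z : Fin m) → Fin (a z) ⊎ Fin (b z) → A ⊎ B
    from-split z (inj₁ k) = inj₁ (from FA (z , k))
    from-split z (inj₂ k) = inj₂ (from FB (z , k))
    from′ : Σ (Fin m) (λ z → Fin (a z + b z)) → A ⊎ B
    from′ (z , k) = from-split z (splitAt (a z) k)
    from-to′ : ∀ x → from′ (to′ x) ≡ x
    from-to′ (inj₁ x) with to FA x | from-to FA x
    ... | z , k | eq rewrite splitAt-↑ˡ (a z) k (b z) = cong inj₁ eq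
    from-to′ (inj₂ y) with to FB y | from-to FB y
    ... | z , k | eq rewrite splitAt-↑ʳ (a z) (b z) k = cong inj₂ eq
    to-from′ : ∀ w → to′ (from′ w) ≡ w
    to-from′ (z , k) with splitAt (a z) k in eq
    ... | inj₁ k′ rewrite to-from FA (z , k′) = cong (z ,_) (splitAt⁻¹-↑ˡ eq)
    ... | inj₂ k′ rewrite to-from FB (z , k′) = cong (z ,_) (splitAt⁻¹-↑ʳ eq)
    proj₁-to′ : ∀ x → proj₁ (to′ x) ≡ [ clA , clB ] x
    proj₁-to′ (inj₁ x) = proj₁-to FA x
    proj₁-to′ (inj₂ y) = proj₁-to FB y

  Σ-suc↔⊎ : ∀ {t} (A : Fin (suc t) → Set) → Σ (Fin (suc t)) A ↔ (A zero ⊎ Σ (Fin t) (A ∘ suc))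
  Σ-suc↔⊎ A = mk↔ₛ′ split join split-join join-split
    where
    split : Σ (Fin _) A → A zero ⊎ Σ (Fin _) (A ∘ suc)
    split (zero , x) = inj₁ x
    split (suc j , x) = inj₂ (j , x)
    join : A zero ⊎ Σ (Fin _) (A ∘ suc) → Σ (Fin _) A
    join (inj₁ x) = zero , x
    join (inj₂ (j , x)) = suc j , x
    split-join : ∀ y → split (join y) ≡ y
    split-join (inj₁ x) = refl
    split-join (inj₂ (j , x)) = refl
    join-split : ∀ y → join (split y) ≡ y
    join-split (zero , x) = refl
    join-split (suc j , x) = refl

  fibres-Σ : ∀ {t} {A : Fin t → Set} {cl : ∀ j → A j → Fin m} {c : Fin t → Fin m → ℕ} →
    (∀ j → FibreSizes (cl j) (c j)) →
    FibreSizes {Σ (Fin t) A} (λ (j , x) → cl j x) (λ z → ∑[ j < t ] c j z)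
  fibres-Σ {zero} F = fibres-⊥ proj₁
  fibres-Σ {suc t} {A} {cl} F = fibres-cong cl≗ (λ _ → refl)
    (fibres-↔ (Σ-suc↔⊎ A) (fibres-⊎ (F zero) (fibres-Σ (F ∘ suc))))
    where
    cl≗ : ∀ p → [ cl zero , (λ (j , x) → cl (suc j) x) ] (Inverse.to (Σ-suc↔⊎ A) p) ≡ cl (proj₁ p) (proj₂ p)
    cl≗ (zero , x) = refl
    cl≗ (suc j , x) = refl

  Fin↔Σ⊤ : ∀ {n} → Fin n ↔ Σ (Fin n) (λ _ → ⊤)
  Fin↔Σ⊤ = mk↔ₛ′ (_, tt) proj₁ (λ _ → refl) (λ _ → refl)

  fibres-Fin : ∀ {n} (f : Fin n → Fin m) → FibreSizes f (classSize f)
  fibres-Fin f = fibres-cong (λ _ → refl) (λ z → sym (count-sum (λ x → f x == z)))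
    (fibres-↔ Fin↔Σ⊤ (fibres-Σ (fibres-singleton ∘ f)))

  fibres-copies : ∀ {t h} (g : Fin t → Fin h → Fin m) →
    FibreSizes {Fin t × Fin h} (λ (j , x) → g j x) (λ z → ∑[ j < t ] classSize (g j) z)
  fibres-copies g = fibres-Σ (fibres-Fin ∘ g)

  fibres-unique : ∀ {A : Set} {cl : A → Fin m} {c c′ : Fin m → ℕ} →
    FibreSizes cl c → FibreSizes cl c′ → c ≗ c′
  fibres-unique {cl = cl} F F′ z = ≤-antisym (fibre-≤ F F′) (fibre-≤ F′ F)
    where
    fibre-≤ : ∀ {c c′ : Fin m → ℕ} → FibreSizes cl c → FibreSizes cl c′ → c z ≤ c′ z
    fibre-≤ {c} {c′} F F′ = injective⇒≤ ι-injective
      where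
      lies-over : (w : Σ (Fin m) (Fin ∘ c′)) → proj₁ w ≡ z → Fin (c′ z)
      lies-over (_ , k) refl = k
      lies-over-injective : ∀ w w′ (e : proj₁ w ≡ z) (e′ : proj₁ w′ ≡ z) →
        lies-over w e ≡ lies-over w′ e′ → w ≡ w′
      lies-over-injective _ _ refl refl refl = refl
      image : Fin (c z) → Σ (Fin m) (Fin ∘ c′)
      image k = to F′ (from F (z , k))
      image-over : ∀ k → proj₁ (image k) ≡ z
      image-over k = trans (proj₁-to F′ _) (trans (sym (proj₁-to F _)) (cong proj₁ (to-from F (z , k))))
      ι : Fin (c z) → Fin (c′ z)
      ι k = lies-over (image k) (image-over k)
      ι-injective : ∀ {k k′} → ι k ≡ ι k′ → k ≡ k′
      ι-injective {k} {k′} eq = ,-injectiveʳ-UIP (Decidable⇒UIP.≡-irrelevant _≟_) (begin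
        (z , k)                     ≡⟨ to-from F (z , k) ⟨
        to F (from F (z , k))       ≡⟨ cong (to F) (to-F′-injective (lies-over-injective _ _ (image-over k) (image-over k′) eq)) ⟩
        to F (from F (z , k′))      ≡⟨ to-from F (z , k′) ⟩
        (z , k′)                    ∎)
        where
        open ≡-Reasoning
        to-F′-injective : image k ≡ image k′ → from F (z , k) ≡ from F (z , k′)
        to-F′-injective e = trans (sym (from-to F′ _)) (trans (cong (from F′) e) (from-to F′ _))

module _ (H G : Graph) {m : ℕ} (P : Fin (order G) → Fin m) where

  -- every injective lift of f through P is an embedding of H into G
  Realisable : (Fin (order H) → Fin m) → Set
  Realisable f = ∀ x y u v → adj H x y ≡ true → P u ≡ f x → P v ≡ f y → u ≢ v → adj G u v ≡ true

  packing-from-colourings : ∀ t (g : Fin t → Fin (order H) → Fin m) → (∀ j → Realisable (g j)) →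
    (∀ z → ∑[ j < t ] classSize (g j) z ≡ classSize P z) → PerfectPacking H G
  packing-from-colourings t g realisable sizes = t , φ , edges , injective , surjective
    where
    FH : FibreSizes {Fin t × Fin (order H)} (λ (j , x) → g j x) (λ z → ∑[ j < t ] classSize (g j) z)
    FH = fibres-copies g
    FG : FibreSizes P (λ z → ∑[ j < t ] classSize (g j) z)
    FG = fibres-cong (λ _ → refl) (sym ∘ sizes) (fibres-Fin P)
    φ : Fin t → Fin (order H) → Fin (order G)
    φ j x = from FG (to FH (j , x))
    P∘φ : ∀ j x → P (φ j x) ≡ g j x
    P∘φ j x = trans (sym (proj₁-to FG _)) (trans (cong proj₁ (to-from FG _)) (proj₁-to FH (j , x)))
    injective : ∀ i j x y → φ i x ≡ φ j y → i ≡ j × x ≡ y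
    injective i j x y eq = ,-injective (begin
      (i , x)                       ≡⟨ from-to FH (i , x) ⟨
      from FH (to FH (i , x))       ≡⟨ cong (from FH) (trans (sym (to-from FG _)) (trans (cong (to FG) eq) (to-from FG _))) ⟩
      from FH (to FH (j , y))       ≡⟨ from-to FH (j , y) ⟩
      (j , y)                       ∎)
      where open ≡-Reasoning
    edges : ∀ j x y → adj H x y ≡ true → adj G (φ j x) (φ j y) ≡ true
    edges j x y xy = realisable j x y (φ j x) (φ j y) xy (P∘φ j x) (P∘φ j y) φx≢φy
      where
      φx≢φy : φ j x ≢ φ j y
      φx≢φy eq with proj₂ (injective j j x y eq)
      ... | refl = contradiction (trans (sym xy) (irrefl H x)) λ ()
    surjective : ∀ v → ∃[ i ] ∃[ x ] φ i x ≡ v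
    surjective v = let (i , x) = from FH (to FG v) in
      i , x , trans (cong (from FG) (to-from FH (to FG v))) (from-to FG v)

  packing-classSizes : ∀ {t} (φ : Fin t → Fin (order H) → Fin (order G)) →
    (∀ i j x y → φ i x ≡ φ j y → i ≡ j × x ≡ y) → (∀ v → ∃[ i ] ∃[ x ] φ i x ≡ v) →
    ∀ z → ∑[ j < t ] classSize (P ∘ φ j) z ≡ classSize P z
  packing-classSizes {t} φ injective surjective =
    fibres-unique (fibres-copies (λ j → P ∘ φ j)) (fibres-↔ copies↔V (fibres-Fin P))
    where
    copies↔V : (Fin t × Fin (order H)) ↔ Fin (order G)
    copies↔V = mk↔ₛ′ (λ (j , x) → φ j x) (λ v → let (i , x , _) = surjective v in i , x)
      (λ v → proj₂ (proj₂ (surjective v)))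
      (λ (j , x) → let (i≡j , x≡y) = injective _ _ _ _ (proj₂ (proj₂ (surjective (φ j x)))) in cong₂ _,_ i≡j x≡y)

module _ {L : ℕ} .{{_ : NonZero L}} where

  infixl 6 _⊕_

  _⊕_ : Fin L → Fin L → Fin L
  y ⊕ r = (toℕ y + toℕ r) mod L

  ⊖_ : Fin L → Fin L
  ⊖ y = (L ∸ toℕ y) mod L

  private
    toℕ-mod : ∀ n → toℕ (n mod L) ≡ n % L
    toℕ-mod n = toℕ-fromℕ< _

    toℕ≡%L : ∀ (w : Fin L) → toℕ w ≡ toℕ w % L
    toℕ≡%L w = sym (m<n⇒m%n≡m (toℕ<n w))

    toℕ-⊕ : ∀ {x y : Fin L} {a b} → toℕ x ≡ a % L → toℕ y ≡ b % L → toℕ (x ⊕ y) ≡ (a + b) % L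
    toℕ-⊕ {x} {y} {a} {b} x≡ y≡ = begin
      toℕ (x ⊕ y)                ≡⟨ toℕ-mod _ ⟩
      (toℕ x + toℕ y) % L        ≡⟨ cong₂ (λ p q → (p + q) % L) x≡ y≡ ⟩
      (a % L + b % L) % L        ≡⟨ %-distribˡ-+ a b L ⟨
      (a + b) % L                ∎
      where open ≡-Reasoning

    ⊕-≡ : ∀ {x y : Fin L} {a b} (w : Fin L) → toℕ x ≡ a % L → toℕ y ≡ b % L → a + b ≡ toℕ w + L → x ⊕ y ≡ w
    ⊕-≡ {a = a} {b} w x≡ y≡ a+b≡ = toℕ-injective (begin
      _                          ≡⟨ toℕ-⊕ x≡ y≡ ⟩
      (a + b) % L                ≡⟨ cong (_% L) a+b≡ ⟩
      (toℕ w + L) % L            ≡⟨ [m+n]%n≡m%n (toℕ w) L ⟩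
      toℕ w % L                  ≡⟨ toℕ≡%L w ⟨
      toℕ w                      ∎)
      where open ≡-Reasoning

    y+[L∸y]≡L : ∀ (y : Fin L) → toℕ y + (L ∸ toℕ y) ≡ L
    y+[L∸y]≡L y = m+[n∸m]≡n (<⇒≤ (toℕ<n y))

  ⊕-comm : ∀ y r → y ⊕ r ≡ r ⊕ y
  ⊕-comm y r = cong (_mod L) (+-comm (toℕ y) (toℕ r))

  ⊖-cancelˡ : ∀ y r → ⊖ y ⊕ (y ⊕ r) ≡ r
  ⊖-cancelˡ y r = ⊕-≡ r (toℕ-mod _) (toℕ-mod _) (begin
    L ∸ toℕ y + (toℕ y + toℕ r)   ≡⟨ +-assoc (L ∸ toℕ y) (toℕ y) (toℕ r) ⟨
    L ∸ toℕ y + toℕ y + toℕ r     ≡⟨ cong (_+ toℕ r) (trans (+-comm (L ∸ toℕ y) (toℕ y)) (y+[L∸y]≡L y)) ⟩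
    L + toℕ r                     ≡⟨ +-comm L (toℕ r) ⟩
    toℕ r + L                     ∎)
    where open ≡-Reasoning

  ⊖-cancelʳ : ∀ y w → y ⊕ (⊖ y ⊕ w) ≡ w
  ⊖-cancelʳ y w = ⊕-≡ w (toℕ≡%L y) (toℕ-⊕ (toℕ-mod _) (toℕ≡%L w)) (begin
    toℕ y + (L ∸ toℕ y + toℕ w)   ≡⟨ +-assoc (toℕ y) (L ∸ toℕ y) (toℕ w) ⟨
    toℕ y + (L ∸ toℕ y) + toℕ w   ≡⟨ cong (_+ toℕ w) (y+[L∸y]≡L y) ⟩
    L + toℕ w                     ≡⟨ +-comm L (toℕ w) ⟩
    toℕ w + L                     ∎)
    where open ≡-Reasoning

  ⊕-injectiveʳ : ∀ y → Injective _≡_ _≡_ (y ⊕_)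
  ⊕-injectiveʳ y {r} {r′} eq = begin
    r                 ≡⟨ ⊖-cancelˡ y r ⟨
    ⊖ y ⊕ (y ⊕ r)     ≡⟨ cong (⊖ y ⊕_) eq ⟩
    ⊖ y ⊕ (y ⊕ r′)    ≡⟨ ⊖-cancelˡ y r′ ⟩
    r′                ∎
    where open ≡-Reasoning

  ⊕-injectiveˡ : ∀ r → Injective _≡_ _≡_ (_⊕ r)
  ⊕-injectiveˡ r {y} {y′} eq = ⊕-injectiveʳ r (trans (⊕-comm r y) (trans eq (⊕-comm y′ r)))

  ∑-⊕-indicator : ∀ y w → ∑[ r < L ] ⟦ (y ⊕ r) == w ⟧ ≡ 1
  ∑-⊕-indicator y w = ∑-unique (λ r → (y ⊕ r) == w) (⊖ y ⊕ w) (≡⇒== (⊖-cancelʳ y w))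
    (λ r eq → ⊕-injectiveʳ y (trans (==⇒≡ eq) (sym (⊖-cancelʳ y w))))

⊕-identityʳ : ∀ {L} (y : Fin (suc L)) → y ⊕ zero ≡ y
⊕-identityʳ y = toℕ-injective (trans (toℕ-fromℕ< _) (trans (cong (_% _) (+-identityʳ (toℕ y))) (m<n⇒m%n≡m (toℕ<n y))))

module _ {n : ℕ} (σ : Permutation′ n) where

  permute-injective : Injective _≡_ _≡_ (σ ⟨$⟩ʳ_)
  permute-injective {u} {v} eq = trans (sym (inverseˡ σ)) (trans (cong (σ ⟨$⟩ˡ_) eq) (inverseˡ σ))

  ==-permute : ∀ u z → ((σ ⟨$⟩ʳ u) == z) ≡ (u == (σ ⟨$⟩ˡ z))
  ==-permute u z with u ≟ σ ⟨$⟩ˡ z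
  ... | yes refl = ≡⇒== (inverseʳ σ)
  ... | no u≢σ⁻¹z = ≢⇒== (λ eq → u≢σ⁻¹z (trans (sym (inverseˡ σ)) (cong (σ ⟨$⟩ˡ_) eq)))

  classSize-permute : ∀ {h} (c : Fin h → Fin n) z → classSize ((σ ⟨$⟩ʳ_) ∘ c) z ≡ classSize c (σ ⟨$⟩ˡ z)
  classSize-permute c z = count-cong (λ x → ==-permute (c x) z)

module _ {n : ℕ} where

  transpose-source : ∀ (i j : Fin n) → transpose i j ⟨$⟩ʳ i ≡ j
  transpose-source i j with i ≟ i
  ... | yes _ = refl
  ... | no i≢i = contradiction refl i≢i

  transpose-target : ∀ (i j : Fin n) → transpose i j ⟨$⟩ʳ j ≡ i
  transpose-target i j with j ≟ i
  ... | yes j≡i = j≡i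
  ... | no _ with j ≟ j
  ...   | yes _ = refl
  ...   | no j≢j = contradiction refl j≢j

  transpose-other : ∀ {i j k : Fin n} → k ≢ i → k ≢ j → transpose i j ⟨$⟩ʳ k ≡ k
  transpose-other {i} {j} {k} k≢i k≢j with k ≟ i
  ... | yes k≡i = contradiction k≡i k≢i
  ... | no _ with k ≟ j
  ...   | yes k≡j = contradiction k≡j k≢j
  ...   | no _ = refl

  relabelling : ∀ {a b A B : Fin n} → a ≢ b → A ≢ B →
    Σ[ σ ∈ Permutation′ n ] (σ ⟨$⟩ʳ a ≡ A × σ ⟨$⟩ʳ b ≡ B)
  relabelling {a} {b} {A} {B} a≢b A≢B = τ ∘ₚ transpose b′ B , σa≡A , transpose-source b′ B
    where
    τ : Permutation′ n
    τ = transpose a A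
    b′ : Fin n
    b′ = τ ⟨$⟩ʳ b
    σa≡A : transpose b′ B ⟨$⟩ʳ (τ ⟨$⟩ʳ a) ≡ A
    σa≡A rewrite transpose-source a A =
      transpose-other (λ A≡b′ → a≢b (permute-injective τ (trans (transpose-source a A) A≡b′))) A≢B

-- Exchanges and the block construction

record ColouringClass (h L : ℕ) : Set₁ where
  field
    Good : (Fin h → Fin L) → Set
    good? : ∀ f → Dec (Good f)
    good-≗ : ∀ {f g} → f ≗ g → Good f → Good g
    good-∘ : ∀ {π : Fin L → Fin L} → Injective _≡_ _≡_ π → ∀ {f} → Good f → Good (π ∘ f)

totalClassSize : ∀ {h L} → List (Fin h → Fin L) → Fin L → ℕ
totalClassSize [] z = 0
totalClassSize (f ∷ fs) z = classSize f z + totalClassSize fs z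

totalClassSize-++ : ∀ {h L} (fs gs : List (Fin h → Fin L)) z →
  totalClassSize (fs ++ gs) z ≡ totalClassSize fs z + totalClassSize gs z
totalClassSize-++ [] gs z = refl
totalClassSize-++ (f ∷ fs) gs z =
  trans (cong (classSize f z +_) (totalClassSize-++ fs gs z)) (sym (+-assoc (classSize f z) _ _))

-- In class sizes, c′ arises from c by moving d vertices from colour b to colour a.
Shift : ∀ {h L} (c c′ : Fin h → Fin L) (a b : Fin L) → ℕ → Set
Shift c c′ a b d = ∀ y → classSize c′ y + ⟦ y == b ⟧ * d ≡ classSize c y + ⟦ y == a ⟧ * d

-- sizes M for every colour, except that one vertex has moved from colour i₂ to colour i₁
NearlyBalanced : ∀ {L} → (Fin L → ℕ) → ℕ → Fin L → Fin L → Set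
NearlyBalanced size M i₁ i₂ = ∀ z → size z + ⟦ z == i₂ ⟧ ≡ M + ⟦ z == i₁ ⟧

blocks-cancel : ∀ X Y F e₁ e₂ D nP nM r h → X + e₂ * (1 + D) ≡ nP * h + e₁ * (1 + D) →
  Y + e₁ * D ≡ nM * h + e₂ * D → F ≡ r * h → X + (Y + F) + e₂ ≡ (nP + nM + r) * h + e₁
blocks-cancel X Y F e₁ e₂ D nP nM r h X≡ Y≡ F≡ = +-cancelʳ-≡ (e₁ * D + e₂ * D) _ _ (begin
  X + (Y + F) + e₂ + (e₁ * D + e₂ * D)                    ≡⟨ regroup X Y F e₁ e₂ D ⟩
  (X + e₂ * (1 + D)) + (Y + e₁ * D) + F                   ≡⟨ cong₂ (λ p q → p + q + F) X≡ Y≡ ⟩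
  (nP * h + e₁ * (1 + D)) + (nM * h + e₂ * D) + F         ≡⟨ cong ((nP * h + e₁ * (1 + D)) + (nM * h + e₂ * D) +_) F≡ ⟩
  (nP * h + e₁ * (1 + D)) + (nM * h + e₂ * D) + r * h     ≡⟨ collect nP nM r h e₁ e₂ D ⟩
  (nP + nM + r) * h + e₁ + (e₁ * D + e₂ * D)              ∎)
  where
  open ≡-Reasoning
  regroup : ∀ X Y F e₁ e₂ D → X + (Y + F) + e₂ + (e₁ * D + e₂ * D) ≡ (X + e₂ * (1 + D)) + (Y + e₁ * D) + F
  regroup = solve-∀
  collect : ∀ nP nM r h e₁ e₂ D →
    (nP * h + e₁ * (1 + D)) + (nM * h + e₂ * D) + r * h ≡ (nP + nM + r) * h + e₁ + (e₁ * D + e₂ * D)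
  collect = solve-∀

module Exchanges {h L′ : ℕ} (C : ColouringClass h (suc L′)) where
  open ColouringClass C

  L : ℕ
  L = suc L′

  record Exchange : Set where
    field
      old new : Fin h → Fin L
      old-good : Good old
      new-good : Good new
      gainer loser : Fin L
      gainer≢loser : gainer ≢ loser
      amount : ℕ
      shift : Shift old new gainer loser amount
  open Exchange public

  rotation : Permutation′ L → Fin L → (Fin h → Fin L) → Fin h → Fin L
  rotation σ r c = (σ ⟨$⟩ʳ_) ∘ (_⊕ r) ∘ c

  rotation-good : ∀ σ r {c} → Good c → Good (rotation σ r c)
  rotation-good σ r = good-∘ (λ eq → ⊕-injectiveˡ r (permute-injective σ eq))

  rotations : Permutation′ L → (Fin h → Fin L) → List (Fin h → Fin L)
  rotations σ c = tabulate (λ r → rotation σ r c)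

  totalClassSize-tabulate : ∀ {n} (g : Fin n → Fin h → Fin L) z →
    totalClassSize (tabulate g) z ≡ ∑[ j < n ] classSize (g j) z
  totalClassSize-tabulate {zero} g z = refl
  totalClassSize-tabulate {suc n} g z = cong (classSize (g zero) z +_) (totalClassSize-tabulate (g ∘ suc) z)

  totalClassSize-rotations : ∀ σ c z → totalClassSize (rotations σ c) z ≡ h
  totalClassSize-rotations σ c z = begin
    totalClassSize (rotations σ c) z
      ≡⟨ totalClassSize-tabulate (λ r → rotation σ r c) z ⟩
    ∑[ r < L ] classSize (rotation σ r c) z
      ≡⟨ sum-cong-≗ (λ r → count-sum (λ x → rotation σ r c x == z)) ⟩
    ∑[ r < L ] ∑[ x < h ] ⟦ (σ ⟨$⟩ʳ (c x ⊕ r)) == z ⟧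
      ≡⟨ ∑-comm (λ r x → ⟦ (σ ⟨$⟩ʳ (c x ⊕ r)) == z ⟧) ⟩
    ∑[ x < h ] ∑[ r < L ] ⟦ (σ ⟨$⟩ʳ (c x ⊕ r)) == z ⟧
      ≡⟨ sum-cong-≗ (λ x → trans (sum-cong-≗ (λ r → cong ⟦_⟧ (==-permute σ (c x ⊕ r) z)))
                                 (∑-⊕-indicator (c x) (σ ⟨$⟩ˡ z))) ⟩
    ∑[ x < h ] 1
      ≡⟨ ∑-const h 1 ⟩
    h * 1
      ≡⟨ *-identityʳ h ⟩
    h ∎
    where open ≡-Reasoning

  rotations-good : ∀ σ {c} → Good c → All Good (rotations σ c)
  rotations-good σ {c} good-c = tabulate-good (λ r → rotation-good σ r good-c)
    where
    tabulate-good : ∀ {n} {g : Fin n → Fin h → Fin L} → (∀ r → Good (g r)) → All Good (tabulate g)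
    tabulate-good {zero} good-g = []
    tabulate-good {suc n} good-g = good-g zero ∷ tabulate-good (good-g ∘ suc)

  ==-relabel : ∀ (σ : Permutation′ L) {a A} → σ ⟨$⟩ʳ a ≡ A → ∀ z → (z == A) ≡ ((σ ⟨$⟩ˡ z) == a)
  ==-relabel σ {a} refl z = trans (==-sym z (σ ⟨$⟩ʳ a)) (trans (==-permute σ a z) (==-sym a (σ ⟨$⟩ˡ z)))

  module _ (w : Exchange) {A B : Fin L} (A≢B : A ≢ B) where
    private
      σ : Permutation′ L
      σ = proj₁ (relabelling (gainer≢loser w) A≢B)
      σ-gainer : σ ⟨$⟩ʳ gainer w ≡ A
      σ-gainer = proj₁ (proj₂ (relabelling (gainer≢loser w) A≢B))
      σ-loser : σ ⟨$⟩ʳ loser w ≡ B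
      σ-loser = proj₂ (proj₂ (relabelling (gainer≢loser w) A≢B))
      later-rotations : List (Fin h → Fin L)
      later-rotations = tabulate (λ r → rotation σ (suc r) (old w))

    -- The rotations of old use every colour h times; putting new in place of the identity
    -- rotation, relabelled so that gainer and loser become A and B, moves amount from B to A.
    block : List (Fin h → Fin L)
    block = ((σ ⟨$⟩ʳ_) ∘ new w) ∷ later-rotations

    block-good : All Good block
    block-good with rotations-good σ (old-good w)
    ... | _ ∷ later-good = good-∘ (permute-injective σ) (new-good w) ∷ later-good

    block-total : ∀ z → totalClassSize block z + ⟦ z == B ⟧ * amount w ≡ h + ⟦ z == A ⟧ * amount w
    block-total z = begin
      classSize ((σ ⟨$⟩ʳ_) ∘ new w) z + T + ⟦ z == B ⟧ * d
        ≡⟨ cong₂ (λ p q → p + T + ⟦ q ⟧ * d) (classSize-permute σ (new w) z) (==-relabel σ σ-loser z) ⟩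
      classSize (new w) y + T + ⟦ y == loser w ⟧ * d
        ≡⟨ swap-last (classSize (new w) y) T _ ⟩
      classSize (new w) y + ⟦ y == loser w ⟧ * d + T
        ≡⟨ cong (_+ T) (shift w y) ⟩
      classSize (old w) y + ⟦ y == gainer w ⟧ * d + T
        ≡⟨ swap-last (classSize (old w) y) T _ ⟨
      classSize (old w) y + T + ⟦ y == gainer w ⟧ * d
        ≡⟨ cong₂ (λ p q → p + T + ⟦ q ⟧ * d) (sym (classSize-permute σ (old w) z)) (sym (==-relabel σ σ-gainer z)) ⟩
      classSize ((σ ⟨$⟩ʳ_) ∘ old w) z + T + ⟦ z == A ⟧ * d
        ≡⟨ cong (λ p → p + T + ⟦ z == A ⟧ * d)
             (count-cong (λ x → cong (λ u → (σ ⟨$⟩ʳ u) == z) (sym (⊕-identityʳ (old w x))))) ⟩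
      totalClassSize (rotations σ (old w)) z + ⟦ z == A ⟧ * d
        ≡⟨ cong (_+ ⟦ z == A ⟧ * d) (totalClassSize-rotations σ (old w) z) ⟩
      h + ⟦ z == A ⟧ * d ∎
      where
      open ≡-Reasoning
      d T : ℕ
      d = amount w
      T = totalClassSize later-rotations z
      y : Fin L
      y = σ ⟨$⟩ˡ z
      swap-last : ∀ a t b → a + t + b ≡ a + b + t
      swap-last = solve-∀

  module _ {A B : Fin L} (A≢B : A ≢ B) where

    blocks : List Exchange → List (Fin h → Fin L)
    blocks [] = []
    blocks (w ∷ ws) = block w A≢B ++ blocks ws

    blocks-good : ∀ ws → All Good (blocks ws)
    blocks-good [] = []
    blocks-good (w ∷ ws) = ++⁺ (block-good w A≢B) (blocks-good ws)

    blocks-total : ∀ ws z → let D = Σval amount ws in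
      totalClassSize (blocks ws) z + ⟦ z == B ⟧ * D ≡ length ws * h + ⟦ z == A ⟧ * D
    blocks-total [] z = trans (*-zeroʳ ⟦ z == B ⟧) (sym (*-zeroʳ ⟦ z == A ⟧))
    blocks-total (w ∷ ws) z = begin
      totalClassSize (block w A≢B ++ blocks ws) z + [B] * (d + D)
        ≡⟨ cong₂ _+_ (totalClassSize-++ (block w A≢B) (blocks ws) z) (*-distribˡ-+ [B] d D) ⟩
      (X + Y) + ([B] * d + [B] * D)
        ≡⟨ interchange X Y ([B] * d) ([B] * D) ⟩
      (X + [B] * d) + (Y + [B] * D)
        ≡⟨ cong₂ _+_ (block-total w A≢B z) (blocks-total ws z) ⟩
      (h + [A] * d) + (length ws * h + [A] * D)
        ≡⟨ interchange h ([A] * d) (length ws * h) ([A] * D) ⟩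
      (h + length ws * h) + ([A] * d + [A] * D)
        ≡⟨ cong ((h + length ws * h) +_) (*-distribˡ-+ [A] d D) ⟨
      (h + length ws * h) + [A] * (d + D) ∎
      where
      open ≡-Reasoning
      d D [A] [B] X Y : ℕ
      d = amount w
      D = Σval amount ws
      [A] = ⟦ z == A ⟧
      [B] = ⟦ z == B ⟧
      X = totalClassSize (block w A≢B) z
      Y = totalClassSize (blocks ws) z
      interchange : ∀ a b c e → a + b + (c + e) ≡ a + c + (b + e)
      interchange = solve-∀

  padding : (Fin h → Fin L) → ℕ → List (Fin h → Fin L)
  padding c zero = []
  padding c (suc n) = rotations idₚ c ++ padding c n

  padding-good : ∀ {c} → Good c → ∀ n → All Good (padding c n)
  padding-good good-c zero = []
  padding-good good-c (suc n) = ++⁺ (rotations-good idₚ good-c) (padding-good good-c n)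

  padding-total : ∀ c n z → totalClassSize (padding c n) z ≡ n * h
  padding-total c zero z = refl
  padding-total c (suc n) z = trans (totalClassSize-++ (rotations idₚ c) (padding c n) z)
                                    (cong₂ _+_ (totalClassSize-rotations idₚ c z) (padding-total c n z))

  design : ∀ {c₀} → Good c₀ → ∀ {i₁ i₂} → i₁ ≢ i₂ → (Ps Ms : List Exchange) →
    Σval amount Ps ≡ 1 + Σval amount Ms → ∀ k′ → length Ps + length Ms ≤ k′ →
    Σ[ fs ∈ List (Fin h → Fin L) ] (All Good fs × NearlyBalanced (totalClassSize fs) (k′ * h) i₁ i₂)
  design {c₀} good-c₀ {i₁} {i₂} i₁≢i₂ Ps Ms ΣP≡1+ΣM k′ Ps+Ms≤k′ = fs , good , total
    where
    i₂≢i₁ : i₂ ≢ i₁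
    i₂≢i₁ = i₁≢i₂ ∘ sym
    r : ℕ
    r = k′ ∸ (length Ps + length Ms)
    fs : List (Fin h → Fin L)
    fs = blocks i₁≢i₂ Ps ++ (blocks i₂≢i₁ Ms ++ padding c₀ r)
    good : All Good fs
    good = ++⁺ (blocks-good i₁≢i₂ Ps) (++⁺ (blocks-good i₂≢i₁ Ms) (padding-good good-c₀ r))
    total : NearlyBalanced (totalClassSize fs) (k′ * h) i₁ i₂
    total z = begin
      totalClassSize fs z + ⟦ z == i₂ ⟧
        ≡⟨ cong (_+ ⟦ z == i₂ ⟧) (trans (totalClassSize-++ (blocks i₁≢i₂ Ps) _ z)
                                        (cong (X +_) (totalClassSize-++ (blocks i₂≢i₁ Ms) _ z))) ⟩
      X + (Y + F) + ⟦ z == i₂ ⟧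
        ≡⟨ blocks-cancel X Y F ⟦ z == i₁ ⟧ ⟦ z == i₂ ⟧ (Σval amount Ms) (length Ps) (length Ms) r h
             (subst (λ D → X + ⟦ z == i₂ ⟧ * D ≡ length Ps * h + ⟦ z == i₁ ⟧ * D) ΣP≡1+ΣM (blocks-total i₁≢i₂ Ps z))
             (blocks-total i₂≢i₁ Ms z) (padding-total c₀ r z) ⟩
      (length Ps + length Ms + r) * h + ⟦ z == i₁ ⟧
        ≡⟨ cong (λ n → n * h + ⟦ z == i₁ ⟧) (m+[n∸m]≡n Ps+Ms≤k′) ⟩
      k′ * h + ⟦ z == i₁ ⟧ ∎
      where
      open ≡-Reasoning
      X Y F : ℕ
      X = totalClassSize (blocks i₁≢i₂ Ps) z
      Y = totalClassSize (blocks i₂≢i₁ Ms) z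
      F = totalClassSize (padding c₀ r) z


  shift? : ∀ c c′ a b d → Dec (Shift {h} {L} c c′ a b d)
  shift? c c′ a b d = all? (λ y → classSize c′ y + ⟦ y == b ⟧ * d ℕ.≟ classSize c y + ⟦ y == a ⟧ * d)

  Shift-≗ : ∀ {c₁ c₂ c₁′ c₂′ : Fin h → Fin L} {a b d} → c₁ ≗ c₂ → c₁′ ≗ c₂′ →
    Shift c₁ c₁′ a b d → Shift c₂ c₂′ a b d
  Shift-≗ {a = a} {b} {d} c₁≗c₂ c₁′≗c₂′ shift y =
    subst₂ (λ s s′ → s′ + ⟦ y == b ⟧ * d ≡ s + ⟦ y == a ⟧ * d) (count≗ c₁≗c₂) (count≗ c₁′≗c₂′) (shift y)
    where
    count≗ : ∀ {c c′ : Fin h → Fin L} → c ≗ c′ → classSize c y ≡ classSize c′ y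
    count≗ c≗c′ = count-cong (λ x → cong (_== y) (c≗c′ x))

  gain : (c c′ : Fin h → Fin L) → Fin L → ℕ
  gain c c′ a = classSize c′ a ∸ classSize c a

  Shift⇒gain : ∀ {c c′ a b d} → a ≢ b → Shift c c′ a b d → d ≡ gain c c′ a
  Shift⇒gain {c} {c′} {a} {b} {d} a≢b shift = sym (begin
    classSize c′ a ∸ classSize c a
      ≡⟨ cong (_∸ classSize c a) (+-identityʳ _) ⟨
    classSize c′ a + 0 ∸ classSize c a
      ≡⟨ cong (λ e → classSize c′ a + ⟦ e ⟧ * d ∸ classSize c a) (≢⇒== a≢b) ⟨
    classSize c′ a + ⟦ a == b ⟧ * d ∸ classSize c a
      ≡⟨ cong (_∸ classSize c a) (shift a) ⟩
    classSize c a + ⟦ a == a ⟧ * d ∸ classSize c a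
      ≡⟨ cong (λ e → classSize c a + ⟦ e ⟧ * d ∸ classSize c a) (==-refl a) ⟩
    classSize c a + (d + 0) ∸ classSize c a
      ≡⟨ m+n∸m≡n (classSize c a) (d + 0) ⟩
    d + 0
      ≡⟨ +-identityʳ d ⟩
    d ∎)
    where open ≡-Reasoning

  exchangesBetween : (c c′ : Fin h → Fin L) (a b : Fin L) → List Exchange
  exchangesBetween c c′ a b with good? c ×-dec good? c′ ×-dec ¬? (a ≟ b) ×-dec shift? c c′ a b (gain c c′ a)
  ... | yes (good-c , good-c′ , a≢b , shift) = record
    { old = c ; new = c′ ; old-good = good-c ; new-good = good-c′ ; gainer = a ; loser = b
    ; gainer≢loser = a≢b ; amount = gain c c′ a ; shift = shift } ∷ []
  ... | no _ = []

  exchangesBetween-complete : ∀ {c c′ a b d} → Good c → Good c′ → a ≢ b → Shift c c′ a b d →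
    ∃[ w ] (w ∈ exchangesBetween c c′ a b × amount w ≡ d)
  exchangesBetween-complete {c} {c′} {a} {b} good-c good-c′ a≢b shift
    with good? c ×-dec good? c′ ×-dec ¬? (a ≟ b) ×-dec shift? c c′ a b (gain c c′ a)
  ... | yes _ = _ , here refl , sym (Shift⇒gain {c} {c′} a≢b shift)
  ... | no ¬all = contradiction (good-c , good-c′ , a≢b , subst (Shift c c′ a b) (Shift⇒gain {c} {c′} a≢b shift) shift) ¬all

  exchanges : List Exchange
  exchanges = concatMap (λ c → concatMap (λ c′ → concatMap (λ a → concatMap (exchangesBetween c c′ a)
    (allFin L)) (allFin L)) (functions h L)) (functions h L)

  exchanges-complete : ∀ w → ∃[ w′ ] (w′ ∈ exchanges × amount w′ ≡ amount w)
  exchanges-complete w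
    with functions-complete (old w) | functions-complete (new w)
  ... | g , g∈ , g≗old | g′ , g′∈ , g′≗new
    with exchangesBetween-complete (good-≗ (sym ∘ g≗old) (old-good w)) (good-≗ (sym ∘ g′≗new) (new-good w))
           (gainer≢loser w) (Shift-≗ (sym ∘ g≗old) (sym ∘ g′≗new) (shift w))
  ... | w′ , w′∈ , amount≡ = w′ ,
    ∈-concatMap⁺′ g∈ (∈-concatMap⁺′ g′∈
      (∈-concatMap⁺′ (∈-allFin (gainer w)) (∈-concatMap⁺′ (∈-allFin (loser w)) w′∈))) ,
    amount≡

  CoprimeAmounts : Set
  CoprimeAmounts = ∀ d → (∀ w → d ∣ amount w) → d ≤ 1

  private
    bézout : Σ[ P ∈ List Exchange ] Σ[ M ∈ List Exchange ] Σval amount P ≡ gcdᴸ amount exchanges + Σval amount M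
    bézout = bézoutᴸ amount exchanges

  exchanges⁺ exchanges⁻ : List Exchange
  exchanges⁺ = proj₁ bézout
  exchanges⁻ = proj₁ (proj₂ bézout)

  -- the k₀ of the theorem: one block for each exchange in a Bézout relation for all amounts
  threshold : ℕ
  threshold = length exchanges⁺ + length exchanges⁻

  balanced-exchanges : CoprimeAmounts → Σval amount exchanges⁺ ≡ 1 + Σval amount exchanges⁻
  balanced-exchanges coprime = trans (proj₂ (proj₂ bézout)) (cong (_+ Σval amount exchanges⁻) gcd≡1)
    where
    gcd≡1 : gcdᴸ amount exchanges ≡ 1
    gcd≡1 = gcdᴸ≡1 amount exchanges λ d d∣listed → coprime d λ w →
      let (w′ , w′∈ , amount≡) = exchanges-complete w in subst (d ∣_) amount≡ (d∣listed w′∈)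

totalClassSize-lookup : ∀ {h L} (fs : List (Fin h → Fin L)) z →
  ∑[ j < length fs ] classSize (lookup fs j) z ≡ totalClassSize fs z
totalClassSize-lookup [] z = refl
totalClassSize-lookup (f ∷ fs) z = cong (classSize f z +_) (totalClassSize-lookup fs z)

module _ (H G : Graph) {L′ : ℕ} (C : ColouringClass (order H) (suc L′)) where
  open ColouringClass C
  open Exchanges C

  packing-by-exchanges : CoprimeAmounts → ∀ {c₀} → Good c₀ →
    (P : Fin (order G) → Fin (suc L′)) → (∀ f → Good f → Realisable H G P f) →
    ∀ k′ → threshold ≤ k′ → ∀ {i₁ i₂} → i₁ ≢ i₂ → NearlyBalanced (classSize P) (k′ * order H) i₁ i₂ →
    PerfectPacking H G
  packing-by-exchanges coprime good-c₀ P realisable k′ threshold≤k′ {i₁} {i₂} i₁≢i₂ balanced =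
    pack (design good-c₀ i₁≢i₂ exchanges⁺ exchanges⁻ (balanced-exchanges coprime) k′ threshold≤k′)
    where
    pack : Σ[ fs ∈ List (Fin (order H) → Fin (suc L′)) ]
             (All Good fs × NearlyBalanced (totalClassSize fs) (k′ * order H) i₁ i₂) → PerfectPacking H G
    pack (fs , good , totals) = packing-from-colourings H G P (length fs) (lookup fs)
      (λ j → realisable (lookup fs j) (All.lookup good (∈-lookup j)))
      (λ z → trans (totalClassSize-lookup fs z)
        (+-cancelʳ-≡ ⟦ z == i₂ ⟧ (totalClassSize fs z) (classSize P z) (trans (totals z) (sym (balanced z)))))

properColourings : (H : Graph) (ℓ : ℕ) → ColouringClass (order H) ℓ
properColourings H ℓ = record
  { Good = ProperColouring H ℓ
  ; good? = λ f → all? λ x → all? λ y → (adj H x y ≟ᵇ true) →-dec ¬? (f x ≟ f y)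
  ; good-≗ = λ f≗g proper x y xy gx≡gy → proper x y xy (trans (f≗g x) (trans gx≡gy (sym (f≗g y))))
  ; good-∘ = λ π-injective proper x y xy πfx≡πfy → proper x y xy (π-injective πfx≡πfy)
  }

ComponentColouring : (H : Graph) → (Fin (order H) → Fin 2) → Set
ComponentColouring H f = ∀ x y → adj H x y ≡ true → f x ≡ f y

componentColourings : (H : Graph) → ColouringClass (order H) 2
componentColourings H = record
  { Good = ComponentColouring H
  ; good? = λ f → all? λ x → all? λ y → (adj H x y ≟ᵇ true) →-dec (f x ≟ f y)
  ; good-≗ = λ f≗g constant x y xy → trans (sym (f≗g x)) (trans (constant x y xy) (f≗g y))
  ; good-∘ = λ {π} _ constant x y xy → cong π (constant x y xy)
  }

multipartite-realisable : ∀ H {N ℓ} (p : Fin N → Fin ℓ) f → ProperColouring H ℓ f →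
  Realisable H (multipartite N ℓ p) p f
multipartite-realisable H p f proper x y u v xy pu≡fx pv≡fy _ =
  cong not (≢⇒== λ pu≡pv → proper x y xy (trans (sym pu≡fx) (trans pu≡pv pv≡fy)))

twoCliques-realisable : ∀ H {N} a f → ComponentColouring H f → Realisable H (twoCliques N a) (side a) f
twoCliques-realisable H a f constant x y u v xy su≡fx sv≡fy u≢v =
  cong₂ _∧_ (≡⇒== (trans su≡fx (trans (constant x y xy) (sym sv≡fy)))) (cong not (≢⇒== u≢v))

module _ {h L′ : ℕ} (C : ColouringClass h (suc L′)) where
  open ColouringClass C
  open Exchanges C

  swapExchange : ∀ {c} → Good c → ∀ {a b} → a ≢ b → classSize c a ≤ classSize c b → Exchange
  swapExchange {c} good-c {a} {b} a≢b a≤b = record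
    { old = c ; new = (τ ⟨$⟩ʳ_) ∘ c ; old-good = good-c ; new-good = good-∘ (permute-injective τ) good-c
    ; gainer = a ; loser = b ; gainer≢loser = a≢b ; amount = d ; shift = moves }
    where
    τ : Permutation′ (suc L′)
    τ = transpose a b
    d : ℕ
    d = classSize c b ∸ classSize c a
    moves : Shift c ((τ ⟨$⟩ʳ_) ∘ c) a b d
    moves y with y ≟ a
    ... | yes refl rewrite classSize-permute τ c y | transpose-target b y | ≢⇒== a≢b =
      trans (+-identityʳ _) (trans (sym (m+[n∸m]≡n a≤b)) (cong (classSize c y +_) (sym (+-identityʳ d))))
    ... | no y≢a with y ≟ b
    ...   | yes refl rewrite classSize-permute τ c y | transpose-source y a =
      trans (cong (classSize c a +_) (+-identityʳ d)) (trans (m+[n∸m]≡n a≤b) (sym (+-identityʳ _)))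
    ...   | no y≢b rewrite classSize-permute τ c y | transpose-other {i = b} {j = a} y≢b y≢a = refl

module Components (H : Graph) where
  private
    n : ℕ
    n = order H
    V : Set
    V = Fin n

  Reach : ℕ → V → V → Set
  Reach k u v = reach H k u v ≡ true

  reach-suc : ∀ {k u v} → Reach k u v → Reach (suc k) u v
  reach-suc {k} {u} {v} uv rewrite uv = refl

  reach-mono : ∀ {j k u v} → j ≤ k → Reach j u v → Reach k u v
  reach-mono {j} {u = u} {v} j≤k uv with m≤n⇒∃[o]m+o≡n j≤k
  ... | o , refl = go o
    where
    go : ∀ o → Reach (j + o) u v
    go zero = subst (λ k → Reach k u v) (sym (+-identityʳ j)) uv
    go (suc o) = subst (λ k → Reach k u v) (sym (+-suc j o)) (reach-suc {j + o} {u} {v} (go o))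

  reach-refl : ∀ k u → Reach k u u
  reach-refl k u = reach-mono {0} {k} {u} {u} z≤n (==-refl u)

  reach-step : ∀ {k u w v} → Reach k u w → adj H w v ≡ true → Reach (suc k) u v
  reach-step {k} {u} {w} {v} uw wv = trans (cong (reach H k u v ∨_) any≡true) (∨-zeroʳ _)
    where
    any≡true : any (λ w → reach H k u w ∧ adj H w v) (allFin n) ≡ true
    any≡true = Equivalence.to T-≡ (any⁺ _ (tabulate⁺ w (Equivalence.from T-≡ (cong₂ _∧_ uw wv))))

  reach-split : ∀ {k u v} → Reach (suc k) u v → Reach k u v ⊎ ∃[ w ] (Reach k u w × adj H w v ≡ true)
  reach-split {k} {u} {v} uv with reach H k u v in eq
  ... | true = inj₁ refl
  ... | false with tabulate⁻ (any⁻ _ (allFin n) (Equivalence.from T-≡ uv))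
  ...   | w , uw∧wv = let (uw , wv) = Equivalence.to T-∧ uw∧wv in
                      inj₂ (w , Equivalence.to T-≡ uw , Equivalence.to T-≡ wv)

  Stable : ℕ → V → Set
  Stable k u = ∀ v → Reach (suc k) u v → Reach k u v

  step? : ∀ k u v → Dec (Reach (suc k) u v → Reach k u v)
  step? k u v = (reach H (suc k) u v ≟ᵇ true) →-dec (reach H k u v ≟ᵇ true)

  stable? : ∀ k u → Dec (Stable k u)
  stable? k u = all? (step? k u)

  stable-+ : ∀ {k u} → Stable k u → ∀ j → Stable (j + k) u
  stable-+ st zero = st
  stable-+ {k} {u} st (suc j) v uv with reach-split {suc (j + k)} {u} {v} uv
  ... | inj₁ uv′ = uv′
  ... | inj₂ (w , uw , wv) = reach-step {j + k} {u} {w} {v} (stable-+ st j w uw) wv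

  unstable-grows : ∀ {k u} → ¬ Stable k u → count (reach H k u) < count (reach H (suc k) u)
  unstable-grows {k} {u} ¬stable
    with ¬∀⟶∃¬ n (λ v → Reach (suc k) u v → Reach k u v) (step? k u) ¬stable
  ... | v , ¬step = count-< (reach H k u) (reach H (suc k) u) (λ v → reach-suc {k} {u} {v}) v
    (¬-not λ uv → ¬step λ _ → uv)
    (decidable-stable (reach H (suc k) u v ≟ᵇ true) λ ¬uv → ¬step λ uv → contradiction uv ¬uv)

  grows : ∀ k u → (∀ j → j < k → ¬ Stable j u) → k < count (reach H k u)
  grows zero u _ = subst (_< count (reach H 0 u)) (count-false {n} (λ _ → false) λ _ → refl)
    (count-< {n} (λ _ → false) (reach H 0 u) (λ _ ()) u refl (==-refl u))
  grows (suc k) u unstable =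
    ≤-<-trans (grows k u (λ j j<k → unstable j (m<n⇒m<1+n j<k))) (unstable-grows {k} {u} (unstable k ≤-refl))

  -- reach H k u grows strictly until it stabilises, and it has at most n elements
  stabilises : ∀ u → ∃[ s ] (s < n × Stable s u)
  stabilises u with any? (λ (i : Fin n) → stable? (toℕ i) u)
  ... | yes (i , stable) = toℕ i , toℕ<n i , stable
  ... | no none = contradiction (grows n u unstable) (≤⇒≯ (count≤ (reach H n u)))
    where
    unstable : ∀ j → j < n → ¬ Stable j u
    unstable j j<n stable = none (fromℕ< j<n , subst (λ j → Stable j u) (sym (toℕ-fromℕ< j<n)) stable)

  reach-saturated : ∀ {j u v} → Reach j u v → Reach n u v
  reach-saturated {j} {u} {v} uv with stabilises u
  ... | s , s<n , stable = reach-mono {s} {n} {u} {v} (<⇒≤ s<n) (descend j (reach-mono {j} {j + s} {u} {v} (m≤m+n j s) uv))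
    where
    descend : ∀ i → Reach (i + s) u v → Reach s u v
    descend zero uv = uv
    descend (suc i) uv = descend i (stable-+ stable i v uv)

  component-≡ : ∀ u {v w} → adj H v w ≡ true → reach H n u v ≡ reach H n u w
  component-≡ u {v} {w} vw with reach H n u v in uv | reach H n u w in uw
  ... | true | true = refl
  ... | false | false = refl
  ... | true | false = sym (trans (sym uw) (reach-saturated {suc n} {u} {w} (reach-step {n} {u} {v} {w} uv vw)))
  ... | false | true =
    trans (sym uv) (reach-saturated {suc n} {u} {v} (reach-step {n} {u} {w} {v} uw (trans (Graph.sym H w v) vw)))

  private
    ∧-≡-true : ∀ {p q} → (p ∧ q) ≡ true → p ≡ true × q ≡ true
    ∧-≡-true {true} q≡true = refl , q≡true

  AdjacencyClosed : (V → Bool) → Set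
  AdjacencyClosed S = ∀ x y → S x ≡ true → adj H x y ≡ true → S y ≡ true

  closed-reach : ∀ {S} → AdjacencyClosed S → ∀ {x} → S x ≡ true → ∀ k y → Reach k x y → S y ≡ true
  closed-reach {S} closed {x} Sx zero y xy = subst (λ y → S y ≡ true) (==⇒≡ {x = x} {y} xy) Sx
  closed-reach closed {x} Sx (suc k) y xy with reach-split {k} {x} {y} xy
  ... | inj₁ xy′ = closed-reach closed Sx k y xy′
  ... | inj₂ (w , xw , wy) = closed w y (closed-reach closed Sx k w xw) wy

  -- an adjacency-closed set is a disjoint union of components
  ∣-count-closed : ∀ {d} → (∀ v → d ∣ compOrder H v) → ∀ S → AdjacencyClosed S → d ∣ count S
  ∣-count-closed {d} d∣components S closed = go (count S) S closed ≤-refl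
    where
    go : ∀ b S → AdjacencyClosed S → count S ≤ b → d ∣ count S
    go b S closed count≤b with any? (λ x → S x ≟ᵇ true)
    ... | no empty = subst (d ∣_) (sym (count-false S (λ x → ¬-not (λ Sx → empty (x , Sx))))) (divides 0 refl)
    go zero S closed count≤0 | yes (x , Sx) =
      contradiction count≤0 (<⇒≱ (≤-<-trans z≤n (count-< (λ _ → false) S (λ _ ()) x refl Sx)))
    go (suc b) S closed count≤b | yes (x , Sx) = subst (d ∣_) (sym (count-∧-split S C))
      (∣m∣n⇒∣m+n (subst (d ∣_) (count-cong (λ y → sym (S∧C≡C y))) (d∣components x))
                 (go b S∖C S∖C-closed (≤-pred (≤-trans S∖C<S count≤b))))
      where
      C S∖C : Fin n → Bool
      C = reach H n x
      S∖C y = S y ∧ not (C y)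
      S∧C≡C : ∀ y → (S y ∧ C y) ≡ C y
      S∧C≡C y with C y in xy
      ... | true rewrite closed-reach closed Sx n y xy = refl
      ... | false = ∧-zeroʳ (S y)
      S∖C-closed : AdjacencyClosed S∖C
      S∖C-closed y z S∖Cy yz with ∧-≡-true S∖Cy
      ... | Sy , ¬Cy rewrite closed y z Sy yz | component-≡ x (trans (Graph.sym H z y) yz) = ¬Cy
      S∖C<S : count S∖C < count S
      S∖C<S = count-< S∖C S (λ y → proj₁ ∘ ∧-≡-true) x
        (trans (cong (λ c → S x ∧ not c) (reach-refl n x)) (∧-zeroʳ (S x))) Sx

classSize-total₂ : ∀ {h} (c : Fin h → Fin 2) → classSize c zero + classSize c (suc zero) ≡ h
classSize-total₂ c = trans (cong (classSize c zero +_) (sym (+-identityʳ _))) (∑-classSize c)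

module _ {h : ℕ} (C : ColouringClass h 2) where
  open ColouringClass C
  open Exchanges C

  binaryExchange : ∀ {c c′} → Good c → Good c′ → ∀ {d} → classSize c zero + d ≡ classSize c′ zero → Exchange
  binaryExchange {c} {c′} good-c good-c′ {d} c+d≡c′ = record
    { old = c ; new = c′ ; old-good = good-c ; new-good = good-c′ ; gainer = zero ; loser = suc zero
    ; gainer≢loser = λ () ; amount = d ; shift = moves }
    where
    moves : Shift c c′ zero (suc zero) d
    moves zero = trans (+-identityʳ _) (trans (sym c+d≡c′) (cong (classSize c zero +_) (sym (+-identityʳ d))))
    moves (suc zero) = trans (cong (classSize c′ (suc zero) +_) (+-identityʳ d))
      (trans (+-cancelˡ-≡ (classSize c zero) _ _ (begin
        classSize c zero + (classSize c′ (suc zero) + d)    ≡⟨ rearrange (classSize c zero) (classSize c′ (suc zero)) d ⟩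
        classSize c zero + d + classSize c′ (suc zero)      ≡⟨ cong (_+ classSize c′ (suc zero)) c+d≡c′ ⟩
        classSize c′ zero + classSize c′ (suc zero)         ≡⟨ classSize-total₂ c′ ⟩
        h                                                   ≡⟨ classSize-total₂ c ⟨
        classSize c zero + classSize c (suc zero)           ∎))
      (sym (+-identityʳ _)))
      where
      open ≡-Reasoning
      rearrange : ∀ a b d → a + (b + d) ≡ a + d + b
      rearrange = solve-∀

  exchange-between : ∀ {c c′} → Good c → Good c′ →
    ∃[ w ] ∃[ m ] (amount w + m + m ≡ classSize c zero + classSize c′ zero)
  exchange-between {c} {c′} good-c good-c′ with ≤-total (classSize c zero) (classSize c′ zero)
  ... | inj₁ c≤c′ = binaryExchange good-c good-c′ (m+[n∸m]≡n c≤c′) , classSize c zero ,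
    trans (cong (_+ classSize c zero) (m∸n+n≡m c≤c′)) (+-comm (classSize c′ zero) (classSize c zero))
  ... | inj₂ c′≤c = binaryExchange good-c′ good-c (m+[n∸m]≡n c′≤c) , classSize c′ zero ,
    cong (_+ classSize c′ zero) (m∸n+n≡m c′≤c)

module _ (H : Graph) where
  open Components H
  private
    n : ℕ
    n = order H

  componentIndicator : Fin n → Fin n → Fin 2
  componentIndicator v x = if reach H n v x then suc zero else zero

  componentIndicator-good : ∀ v → ComponentColouring H (componentIndicator v)
  componentIndicator-good v x y xy = cong (λ b → if b then suc zero else zero) (component-≡ v xy)

  classSize-componentIndicator : ∀ v → classSize (componentIndicator v) (suc zero) ≡ compOrder H v
  classSize-componentIndicator v = count-cong λ x → indicator (reach H n v x)
    where
    indicator : ∀ b → ((if b then suc zero else zero) == suc {1} zero) ≡ b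
    indicator true = refl
    indicator false = refl

  componentExchange : Fin n → Exchanges.Exchange (componentColourings H)
  componentExchange v = binaryExchange (componentColourings H) {c′ = zeros} (componentIndicator-good v) (λ _ _ _ → refl)
    (begin
      classSize (componentIndicator v) zero + compOrder H v
        ≡⟨ cong (classSize (componentIndicator v) zero +_) (classSize-componentIndicator v) ⟨
      classSize (componentIndicator v) zero + classSize (componentIndicator v) (suc zero)
        ≡⟨ classSize-total₂ (componentIndicator v) ⟩
      n
        ≡⟨ classSize-total₂ zeros ⟨
      classSize zeros zero + classSize zeros (suc zero)
        ≡⟨ cong (classSize zeros zero +_) (count-false (λ x → zeros x == suc zero) λ _ → refl) ⟩
      classSize zeros zero + 0
        ≡⟨ +-identityʳ _ ⟩
      classSize zeros zero ∎)
    where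
    open ≡-Reasoning
    zeros : Fin n → Fin 2
    zeros _ = zero

  flipIf : Bool → Fin 2 → Fin 2
  flipIf true = opposite
  flipIf false = λ i → i

  flipIf-injective : ∀ b {i j} → flipIf b i ≡ flipIf b j → i ≡ j
  flipIf-injective true {i} {j} eq = trans (sym (opposite-involutive i)) (trans (cong opposite eq) (opposite-involutive j))
  flipIf-injective false eq = eq

  flipComponent : (Fin n → Fin 2) → Fin n → Fin n → Fin 2
  flipComponent c v x = flipIf (reach H n v x) (c x)

  flipComponent-proper : ∀ {c} → ProperColouring H 2 c → ∀ v → ProperColouring H 2 (flipComponent c v)
  flipComponent-proper {c} proper v x y xy eq = proper x y xy
    (flipIf-injective (reach H n v y) (subst (λ b → flipIf b (c x) ≡ flipComponent c v y) (component-≡ v xy) eq))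

  flipComponent-classSize : ∀ c v → ∃[ q ] (classSize (flipComponent c v) zero + classSize c zero ≡ compOrder H v + (q + q))
  flipComponent-classSize c v = ∑[ x < n ] ⟦ outside x ⟧ , (begin
    classSize (flipComponent c v) zero + classSize c zero
      ≡⟨ cong₂ _+_ (count-sum (λ x → flipComponent c v x == zero)) (count-sum (λ x → c x == zero)) ⟩
    ∑[ x < n ] ⟦ flipComponent c v x == zero ⟧ + ∑[ x < n ] ⟦ c x == zero ⟧
      ≡⟨ ∑-distrib-+ (λ x → ⟦ flipComponent c v x == zero ⟧) (λ x → ⟦ c x == zero ⟧) ⟨
    ∑[ x < n ] (⟦ flipComponent c v x == zero ⟧ + ⟦ c x == zero ⟧)
      ≡⟨ sum-cong-≗ (λ x → pointwise (reach H n v x) (c x)) ⟩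
    ∑[ x < n ] (⟦ reach H n v x ⟧ + (⟦ outside x ⟧ + ⟦ outside x ⟧))
      ≡⟨ ∑-distrib-+ (λ x → ⟦ reach H n v x ⟧) (λ x → ⟦ outside x ⟧ + ⟦ outside x ⟧) ⟩
    ∑[ x < n ] ⟦ reach H n v x ⟧ + ∑[ x < n ] (⟦ outside x ⟧ + ⟦ outside x ⟧)
      ≡⟨ cong₂ _+_ (sym (count-sum (reach H n v))) (∑-distrib-+ (λ x → ⟦ outside x ⟧) (λ x → ⟦ outside x ⟧)) ⟩
    compOrder H v + (∑[ x < n ] ⟦ outside x ⟧ + ∑[ x < n ] ⟦ outside x ⟧) ∎)
    where
    open ≡-Reasoning
    outside : Fin n → Bool
    outside x = not (reach H n v x) ∧ (c x == zero)
    pointwise : ∀ b i →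
      ⟦ flipIf b i == zero ⟧ + ⟦ i == zero ⟧ ≡ ⟦ b ⟧ + (⟦ not b ∧ (i == zero) ⟧ + ⟦ not b ∧ (i == zero) ⟧)
    pointwise true zero = refl
    pointwise true (suc zero) = refl
    pointwise false zero = refl
    pointwise false (suc zero) = refl

  odd-exchange : ∀ {c} → ProperColouring H 2 c → ∀ v → ¬ 2 ∣ compOrder H v →
    ∃[ w ] ¬ 2 ∣ Exchanges.amount {C = properColourings H 2} w
  odd-exchange {c} proper v odd
    with exchange-between (properColourings H 2) (flipComponent-proper proper v) proper | flipComponent-classSize c v
  ... | w , m , a+m+m≡ | q , flip+c≡ = w , λ 2∣a → odd (even-transfer {m = m} {q} (trans a+m+m≡ flip+c≡) 2∣a)
    where
    even-transfer : ∀ {a b m q} → a + m + m ≡ b + (q + q) → 2 ∣ a → 2 ∣ b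
    even-transfer {a} {b} {m} {q} eq 2∣a = ∣m+n∣m⇒∣n
      (subst (2 ∣_) (trans (sym (+-assoc a m m)) (trans eq (+-comm b (q + q)))) (∣m∣n⇒∣m+n 2∣a (2∣n+n m)))
      (2∣n+n q)

module _ (H : Graph) (m : ℕ) (c : Fin (order H) → Fin m) where
  private
    sizes : List ℕ
    sizes = sort (classSizes H m c)

  classSize-∈ : ∀ a → classSize c a ∈ sizes
  classSize-∈ a = ∈-resp-↭ (↭-sym (sort-↭ _)) (∈-map⁺ (classSize c) (∈-allFin a))

  ∈⇒classSize : ∀ {x} → x ∈ sizes → ∃[ a ] x ≡ classSize c a
  ∈⇒classSize x∈ with ∈-map⁻ (classSize c) (∈-resp-↭ (sort-↭ _) x∈)
  ... | a , _ , x≡ = a , x≡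

  Dc⇒classSizes : ∀ {d} → d ∈ Dc H m c → ∃[ a ] ∃[ b ] d + classSize c a ≡ classSize c b
  Dc⇒classSizes d∈ with diffs-∈ sizes (sort-↗ _) d∈
  ... | x , y , x∈ , y∈ , d+x≡y with ∈⇒classSize x∈ | ∈⇒classSize y∈
  ...   | a , refl | b , refl = a , b , d+x≡y

  classSizes-mod : ∀ {g} → (∀ {d} → d ∈ Dc H m c → g ∣ d) → ∀ a b → classSize c a ≡ classSize c b [mod g ]
  classSizes-mod g∣Dc a b = sorted-mod sizes (sort-↗ _) g∣Dc (classSize-∈ a) (classSize-∈ b)

module _ (H : Graph) (c : Fin (order H) → Fin 2) where

  Dc-bipartite : (∀ {d} → d ∈ Dc H 2 c → ∃[ x ] d + x + x ≡ order H) × ∃[ d ] d ∈ Dc H 2 c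
  Dc-bipartite with sort (classSizes H 2 c) | sort-↭ (classSizes H 2 c) | sort-↗ (classSizes H 2 c)
  ... | sizes | sizes↭ | sorted with sizes | ↭-length sizes↭ | sum-↭ sizes↭ | sorted
  ...   | x ∷ y ∷ [] | refl | x+y+0≡ | x≤y ∷ _ = two-sided , (y ∸ x , here refl)
    where
    two-sided : ∀ {d} → d ∈ (y ∸ x) ∷ [] → ∃[ x ] d + x + x ≡ order H
    two-sided (here refl) = x , (begin
      y ∸ x + x + x      ≡⟨ cong (_+ x) (m∸n+n≡m x≤y) ⟩
      y + x              ≡⟨ +-comm y x ⟩
      x + y              ≡⟨ cong (x +_) (+-identityʳ y) ⟨
      x + (y + 0)        ≡⟨ x+y+0≡ ⟩
      classSize c zero + (classSize c (suc zero) + 0) ≡⟨ ∑-classSize c ⟩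
      order H            ∎)
      where open ≡-Reasoning

module _ (H : Graph) (L′ : ℕ) where
  open Exchanges (properColourings H (suc L′))

  exchanges-divide-D : ∀ {g} → (∀ w → g ∣ amount w) → CommonDivD H (suc L′) g
  exchanges-divide-D {g} g∣amounts d (c , proper , d∈) with Dc⇒classSizes H _ c d∈
  ... | a , b , d+a≡b with a ≟ b
  ...   | yes refl = subst (g ∣_) (sym (+-cancelʳ-≡ (classSize c a) d 0 d+a≡b)) (divides 0 refl)
  ...   | no a≢b = subst (g ∣_) (trans (cong (_∸ classSize c a) (sym d+a≡b)) (m+n∸n≡m d (classSize c a)))
    (g∣amounts (swapExchange (properColourings H (suc L′)) proper a≢b (subst (classSize c a ≤_) d+a≡b (m≤n+m _ d))))

⌊/⌋-ℓ* : ∀ L k h → (suc L * k * h) ⌊/⌋ suc L ≡ k * h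
⌊/⌋-ℓ* L k h = trans (cong (_/ suc L) (ℓ*≡*ℓ L k h)) (m*n/n≡m (k * h) (suc L))
  where
  ℓ*≡*ℓ : ∀ L k h → suc L * k * h ≡ k * h * suc L
  ℓ*≡*ℓ = solve-∀

⌈/⌉-ℓ* : ∀ L k h → (suc L * k * h) ⌈/⌉ suc L ≡ k * h
⌈/⌉-ℓ* L k h = begin
  (suc L * k * h + L) / suc L             ≡⟨ cong (λ n → (n + L) / suc L) (ℓ*≡*ℓ L k h) ⟩
  (k * h * suc L + L) / suc L             ≡⟨ +-distrib-/-∣ˡ L (divides (k * h) refl) ⟩
  k * h * suc L / suc L + L / suc L       ≡⟨ cong₂ _+_ (m*n/n≡m (k * h) (suc L)) (m<n⇒m/n≡0 (n<1+n L)) ⟩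
  k * h + 0                               ≡⟨ +-identityʳ (k * h) ⟩
  k * h                                   ∎
  where
  open ≡-Reasoning
  ℓ*≡*ℓ : ∀ L k h → suc L * k * h ≡ k * h * suc L
  ℓ*≡*ℓ = solve-∀

G1-classSizes : ∀ L k h (p : Fin (suc L * k * h) → Fin (suc L)) → G1Classes (suc L * k * h) (suc L) p →
  ∃[ i₁ ] ∃[ i₂ ] (i₁ ≢ i₂ × classSize p i₁ ≡ k * h + 1 × classSize p i₂ ≡ k * h ∸ 1
                   × (∀ i → i ≢ i₁ → i ≢ i₂ → classSize p i ≡ k * h))
G1-classSizes L k h p (i₁ , i₂ , i₁≢i₂ , size₁ , size₂ , between) =
  i₁ , i₂ , i₁≢i₂ , trans size₁ (cong (_+ 1) (⌊/⌋-ℓ* L k h)) , trans size₂ (cong (_∸ 1) (⌈/⌉-ℓ* L k h)) ,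
  λ i i≢i₁ i≢i₂ → let (lower , upper) = between i i≢i₁ i≢i₂ in
    ≤-antisym (subst (classSize p i ≤_) (⌈/⌉-ℓ* L k h) upper) (subst (_≤ classSize p i) (⌊/⌋-ℓ* L k h) lower)

nearlyBalanced : ∀ {N ℓ M} (p : Fin N → Fin ℓ) → 1 ≤ M → ∀ {i₁ i₂} → i₁ ≢ i₂ → classSize p i₁ ≡ M + 1 →
  classSize p i₂ ≡ M ∸ 1 → (∀ i → i ≢ i₁ → i ≢ i₂ → classSize p i ≡ M) → NearlyBalanced (classSize p) M i₁ i₂
nearlyBalanced p M≥1 {i₁} {i₂} i₁≢i₂ size₁ size₂ size z with z ≟ i₁
... | yes refl rewrite ≢⇒== i₁≢i₂ = trans (+-identityʳ _) size₁
... | no z≢i₁ with z ≟ i₂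
...   | yes refl = trans (cong (_+ 1) size₂) (trans (m∸n+n≡m M≥1) (sym (+-identityʳ _)))
...   | no z≢i₂ = cong (_+ 0) (size z z≢i₁ z≢i₂)

classSize-side₀ : ∀ {N} a → a ≤ N → classSize (side {N} a) zero ≡ a
classSize-side₀ {N} a a≤N = trans (count-cong (side₀ {N} a)) (trans (count-sum {N} (λ v → toℕ v <ᵇ a)) (∑-<ᵇ a≤N))
  where
  side₀ : ∀ {N} a (v : Fin N) → (side a v == zero) ≡ (toℕ v <ᵇ a)
  side₀ a v with toℕ v <ᵇ a
  ... | true = refl
  ... | false = refl
  ∑-<ᵇ : ∀ {N a} → a ≤ N → ∑[ v < N ] ⟦ toℕ v <ᵇ a ⟧ ≡ a
  ∑-<ᵇ {N} {zero} _ = ∑-zero {N} _ λ _ → refl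
  ∑-<ᵇ {suc N} {suc a} (s≤s a≤N) = cong suc (∑-<ᵇ a≤N)

classSize-side₁ : ∀ {N} a → a ≤ N → classSize (side {N} a) (suc zero) ≡ N ∸ a
classSize-side₁ {N} a a≤N = begin
  classSize S (suc zero)                          ≡⟨ m+n∸m≡n a _ ⟨
  a + classSize S (suc zero) ∸ a                  ≡⟨ cong (λ s → s + classSize S (suc zero) ∸ a) (classSize-side₀ a a≤N) ⟨
  classSize S zero + classSize S (suc zero) ∸ a   ≡⟨ cong (_∸ a) (classSize-total₂ S) ⟩
  N ∸ a                                           ∎
  where
  open ≡-Reasoning
  S : Fin N → Fin 2
  S = side a

multipartite-packing-mod : ∀ H {N ℓ} (p : Fin N → Fin ℓ) → PerfectPacking H (multipartite N ℓ p) →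
  ∀ {g} → CommonDivD H ℓ g → ∀ i j → classSize p i ≡ classSize p j [mod g ]
multipartite-packing-mod H {N} {ℓ} p (t , φ , edges , injective , surjective) {g} g∣D i j =
  subst₂ (λ a b → a ≡ b [mod g ]) (sizes i) (sizes j)
    (mod-∑ _ _ λ k → classSizes-mod H ℓ (p ∘ φ k) (λ d∈ → g∣D _ (p ∘ φ k , proper k , d∈)) i j)
  where
  sizes : ∀ z → ∑[ j < t ] classSize (p ∘ φ j) z ≡ classSize p z
  sizes = packing-classSizes H (multipartite N ℓ p) p φ injective surjective
  proper : ∀ k → ProperColouring H ℓ (p ∘ φ k)
  proper k x y xy same = contradiction (trans (sym (edges k x y xy)) (cong not (≡⇒== same))) λ ()

twoCliques-packing-∣ : ∀ H {N} a → PerfectPacking H (twoCliques N a) →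
  ∀ {g} → CommonDivC H g → ∀ z → g ∣ classSize (side {N} a) z
twoCliques-packing-∣ H {N} a (t , φ , edges , injective , surjective) {g} g∣C z =
  subst (g ∣_) (packing-classSizes H (twoCliques N a) (side a) φ injective surjective z)
    (∣-∑ _ λ j → ∣-count-closed g∣C _ (closed j))
  where
  open Components H using (AdjacencyClosed; ∣-count-closed)
  same-side : ∀ j x y → adj H x y ≡ true → side a (φ j x) ≡ side a (φ j y)
  same-side j x y xy with side a (φ j x) == side a (φ j y) in same | edges j x y xy
  ... | true | _ = ==⇒≡ same
  closed : ∀ j → AdjacencyClosed (λ x → side a (φ j x) == z)
  closed j x y in-z xy = trans (cong (_== z) (sym (same-side j x y xy))) in-z

side-classSizes : ∀ {N M} → N ≡ M + M → 1 ≤ M → ∀ {a} → a ≡ M + 1 →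
  classSize (side {N} a) zero ≡ M + 1 × classSize (side {N} a) (suc zero) ≡ M ∸ 1
side-classSizes {N} {M} N≡M+M M≥1 {a} a≡M+1 =
  trans (classSize-side₀ a a≤N) a≡M+1 ,
  trans (classSize-side₁ a a≤N) (trans (cong₂ _∸_ N≡M+M a≡M+1) ([m+n]∸[m+o]≡n∸o M M 1))
  where
  a≤N : a ≤ N
  a≤N = subst₂ _≤_ (sym a≡M+1) (sym N≡M+M) (+-monoʳ-≤ M M≥1)

-- Necessity of hcf(H) = 1

third : ∀ {L} (i₁ i₂ : Fin (3 + L)) → ∃[ i₃ ] (i₃ ≢ i₁ × i₃ ≢ i₂)
third i₁ i₂ with zero ≟ i₁ | zero ≟ i₂
... | no 0≢i₁ | no 0≢i₂ = zero , 0≢i₁ , 0≢i₂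
... | yes refl | _ with suc zero ≟ i₂
...   | no 1≢i₂ = suc zero , (λ ()) , 1≢i₂
...   | yes refl = suc (suc zero) , (λ ()) , (λ ())
third i₁ i₂ | no 0≢i₁ | yes refl with suc zero ≟ i₁
...   | no 1≢i₁ = suc zero , 1≢i₁ , (λ ())
...   | yes refl = suc (suc zero) , (λ ()) , (λ ())

order≥1 : ∀ H {ℓ} → IsChromaticNumber H ℓ → 2 ≤ ℓ → 1 ≤ order H
order≥1 H (_ , minimal) 2≤ℓ = ≰⇒> λ h≤0 →
  let noVertex : Fin (order H) → Fin 0
      noVertex u = subst Fin (n≤0⇒n≡0 h≤0) u
  in <⇒≱ (≤-trans (s≤s z≤n) 2≤ℓ) (minimal 0 (noVertex , λ u → contradiction (noVertex u) λ ()))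

hcfχ≡1-of-packing : ∀ H L k′ (p : Fin ((3 + L) * k′ * order H) → Fin (3 + L)) → G1Classes _ _ p →
  PerfectPacking H (multipartite _ _ p) → HcfChi H (3 + L) 1
hcfχ≡1-of-packing H L k′ p classes packing with G1-classSizes (2 + L) k′ (order H) p classes
... | i₁ , i₂ , i₁≢i₂ , size₁ , _ , size with third i₁ i₂
...   | i₃ , i₃≢i₁ , i₃≢i₂ = (λ d _ → 1∣ d) , λ g g∣D → ≤-reflexive (∣1⇒≡1 (+-mod⇒∣
  (subst₂ (λ a b → a ≡ b [mod g ]) size₁ (size i₃ i₃≢i₁ i₃≢i₂) (multipartite-packing-mod H p packing g∣D i₁ i₃))))

D-divisors∣2-of-packing : ∀ H k′ → 1 ≤ k′ * order H → (p : Fin (2 * k′ * order H) → Fin 2) → G1Classes _ _ p →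
  PerfectPacking H (multipartite _ _ p) → ∀ g → CommonDivD H 2 g → g ∣ 2
D-divisors∣2-of-packing H k′ M≥1 p classes packing g g∣D with G1-classSizes 1 k′ (order H) p classes
... | i₁ , i₂ , i₁≢i₂ , size₁ , size₂ , _ = +-mod⇒∣ (subst₂ (λ a b → a ≡ b [mod g ])
  (trans size₁ (M+1≡M∸1+2 M≥1)) size₂ (multipartite-packing-mod H p packing g∣D i₁ i₂))

-- with two colours, every element of D(H) has the parity of |H|
hcfχ≤2 : ∀ H {c₀} → ProperColouring H 2 c₀ → (∀ g → CommonDivD H 2 g → g ∣ 2) → ∃[ g ] (HcfChi H 2 g × g ≤ 2)
hcfχ≤2 H {c₀} proper ∣2 with 2 ∣? order H
... | yes 2∣h = 2 , (2-common , λ g g∣D → ∣⇒≤ (∣2 g g∣D)) , ≤-refl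
  where
  2-common : CommonDivD H 2 2
  2-common d (c , _ , d∈) = let (x , d+x+x≡h) = proj₁ (Dc-bipartite H c) d∈ in
    ∣m+n∣m⇒∣n (subst (2 ∣_) (trans (sym d+x+x≡h) (trans (+-assoc d x x) (+-comm d (x + x)))) 2∣h) (2∣n+n x)
... | no 2∤h = 1 , ((λ d _ → 1∣ d) , at-most-1) , s≤s z≤n
  where
  at-most-1 : ∀ g → CommonDivD H 2 g → g ≤ 1
  at-most-1 g g∣D with ∣⇒≤ (∣2 g g∣D) | g ℕ.≟ 2 | Dc-bipartite H c₀
  ... | g≤2 | no g≢2 | _ = ≤-pred (≤∧≢⇒< g≤2 g≢2)
  ... | _ | yes refl | parity , d₀ , d₀∈ with parity d₀∈
  ...   | x , d₀+x+x≡h = contradiction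
    (subst (2 ∣_) (trans (sym (+-assoc d₀ x x)) d₀+x+x≡h) (∣m∣n⇒∣m+n (g∣D d₀ (c₀ , proper , d₀∈)) (2∣n+n x))) 2∤h

4∣n+n⇒2∣n : ∀ n → 4 ∣ n + n → 2 ∣ n
4∣n+n⇒2∣n n (divides q n+n≡q*4) = divides q (*-cancelʳ-≡ n (q * 2) 2
  (trans (sym (n+n≡n*2 n)) (trans n+n≡q*4 (sym (*-assoc q 2 2)))))
  where
  n+n≡n*2 : ∀ n → n + n ≡ n * 2
  n+n≡n*2 = solve-∀

2∣n⇒4∣n+n : ∀ n → 2 ∣ n → 4 ∣ n + n
2∣n⇒4∣n+n n (divides q refl) = divides q (sym (*-distribˡ-+ q 2 2))

∣-around⇒∣2 : ∀ {d} M → 1 ≤ M → d ∣ M + 1 → d ∣ M ∸ 1 → d ∣ 2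
∣-around⇒∣2 {d} M M≥1 d∣M+1 d∣M-1 = ∣m+n∣m⇒∣n (subst (d ∣_) (M+1≡M∸1+2 M≥1) d∣M+1) d∣M-1

2*k*h≡M+M : ∀ k h → 2 * k * h ≡ k * h + k * h
2*k*h≡M+M = solve-∀

halves-∣ : ∀ H {N M} → N ≡ M + M → ∀ {a} → a ≡ M → PerfectPacking H (twoCliques N a) →
  ∀ {d} → CommonDivC H d → d ∣ M
halves-∣ H {N} {M} N≡M+M {a} a≡M packing d∣C =
  subst (_ ∣_) (trans (classSize-side₀ a (subst₂ _≤_ (sym a≡M) (sym N≡M+M) (m≤m+n M M))) a≡M)
    (twoCliques-packing-∣ H {N} a packing d∣C zero)

near-halves-∣ : ∀ H {N M} → N ≡ M + M → 1 ≤ M → ∀ {a} → a ≡ M + 1 → PerfectPacking H (twoCliques N a) →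
  ∀ {d} → CommonDivC H d → d ∣ M + 1 × d ∣ 2
near-halves-∣ H {N} {M} N≡M+M M≥1 {a} a≡M+1 packing {d} d∣C = d∣M+1 , ∣-around⇒∣2 M M≥1 d∣M+1 d∣M∸1
  where
  sizes : classSize (side {N} a) zero ≡ M + 1 × classSize (side {N} a) (suc zero) ≡ M ∸ 1
  sizes = side-classSizes {N} N≡M+M M≥1 a≡M+1
  d∣M+1 : d ∣ M + 1
  d∣M+1 = subst (d ∣_) (proj₁ sizes) (twoCliques-packing-∣ H {N} a packing d∣C zero)
  d∣M∸1 : d ∣ M ∸ 1
  d∣M∸1 = subst (d ∣_) (proj₂ sizes) (twoCliques-packing-∣ H {N} a packing d∣C (suc zero))

-- A common divisor d ≥ 2 of the component orders divides both clique orders, and then each case of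
-- G2Order contradicts its own condition: with orders N/2, d = hcf_c(H) = 2 gives 4 ∣ N; with orders
-- N/2 ± 1, d = 2 = hcf_c(H) and 4 ∤ N.
hcfc≡1-of-packing : ∀ H k′ → 1 ≤ k′ * order H → ∀ a → G2Order H (2 * k′ * order H) a →
  PerfectPacking H (twoCliques _ a) → HcfC H 1
hcfc≡1-of-packing H k′ M≥1 a (if-X , if-¬X) packing = (λ v → 1∣ _) , at-most-1
  where
  N M : ℕ
  N = 2 * k′ * order H
  M = k′ * order H
  N≡M+M : N ≡ M + M
  N≡M+M = 2*k*h≡M+M k′ (order H)
  ⌊N/2⌋≡M : N ⌊/⌋ 2 ≡ M
  ⌊N/2⌋≡M = ⌊/⌋-ℓ* 1 k′ (order H)

  at-most-1 : ∀ d → CommonDivC H d → d ≤ 1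
  at-most-1 d d∣C with d ≤? 1
  ... | yes d≤1 = d≤1
  ... | no d≰1 = contradiction (¬X⇒X ¬X) ¬X
    where
    ¬X : ¬ (HcfC H 2 × ¬ (4 ∣ N))
    ¬X X@(hcf₂ , 4∤N) = 4∤N (subst (4 ∣_) (sym N≡M+M) (2∣n⇒4∣n+n M (subst (_∣ M) d≡2 d∣M)))
      where
      d∣M : d ∣ M
      d∣M = halves-∣ H N≡M+M (trans (if-X X) ⌊N/2⌋≡M) packing d∣C
      d≡2 : d ≡ 2
      d≡2 = ≤-antisym (proj₂ hcf₂ d d∣C) (≰⇒> d≰1)
    ¬X⇒X : ¬ (HcfC H 2 × ¬ (4 ∣ N)) → HcfC H 2 × ¬ (4 ∣ N)
    ¬X⇒X ¬X′ = (subst (CommonDivC H) d≡2 d∣C , λ d′ d′∣C → ∣⇒≤ (proj₂ (∣M+1∧∣2 d′∣C))) , 4∤N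
      where
      ∣M+1∧∣2 : ∀ {d′} → CommonDivC H d′ → d′ ∣ M + 1 × d′ ∣ 2
      ∣M+1∧∣2 = near-halves-∣ H N≡M+M M≥1 (trans (if-¬X ¬X′) (cong (_+ 1) ⌊N/2⌋≡M)) packing
      d≡2 : d ≡ 2
      d≡2 = ≤-antisym (∣⇒≤ (proj₂ (∣M+1∧∣2 d∣C))) (≰⇒> d≰1)
      4∤N : ¬ (4 ∣ N)
      4∤N 4∣N with ∣1⇒≡1 (∣m+n∣m⇒∣n (subst (_∣ M + 1) d≡2 (proj₁ (∣M+1∧∣2 d∣C)))
                                     (4∣n+n⇒2∣n M (subst (4 ∣_) N≡M+M 4∣N)))
      ... | ()

-- Sufficiency of hcf(H) = 1

open Exchanges using (CoprimeAmounts; threshold)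

proper-coprime : ∀ H L′ → HcfChi H (suc L′) 1 → CoprimeAmounts (properColourings H (suc L′))
proper-coprime H L′ (_ , at-most-1) d d∣amounts = at-most-1 d (exchanges-divide-D H L′ d∣amounts)

component-coprime : ∀ H → HcfC H 1 → CoprimeAmounts (componentColourings H)
component-coprime H (_ , at-most-1) d d∣amounts = at-most-1 d (λ v → d∣amounts (componentExchange H v))

odd-component : ∀ H → HcfC H 1 → ∃[ v ] ¬ 2 ∣ compOrder H v
odd-component H (_ , at-most-1) with any? (λ v → ¬? (2 ∣? compOrder H v))
... | yes odd = odd
... | no none = contradiction (at-most-1 2 even) λ { (s≤s ()) }
  where
  even : CommonDivC H 2
  even v = decidable-stable (2 ∣? compOrder H v) (λ odd → none (v , odd))

bipartite-coprime : ∀ H {c₀} → ProperColouring H 2 c₀ → HcfC H 1 → ∃[ g ] (HcfChi H 2 g × g ≤ 2) →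
  CoprimeAmounts (properColourings H 2)
bipartite-coprime H proper hcf-c (g , (_ , at-most-g) , g≤2) d d∣amounts
  with odd-component H hcf-c
... | v , odd with odd-exchange H proper v odd
...   | w , odd-amount = small d (≤-trans (at-most-g d (exchanges-divide-D H 1 d∣amounts)) g≤2) (d∣amounts w)
  where
  small : ∀ d → d ≤ 2 → d ∣ Exchanges.amount w → d ≤ 1
  small zero _ 0∣ = contradiction (subst (2 ∣_) (sym (0∣⇒≡0 0∣)) (divides 0 refl)) odd-amount
  small (suc zero) _ _ = ≤-refl
  small (suc (suc zero)) _ 2∣ = contradiction 2∣ odd-amount
  small (suc (suc (suc _))) (s≤s (s≤s ())) _

χ≥3-equivalence : ∀ H L → IsChromaticNumber H (3 + L) → ∀ k′ → 1 ≤ k′ →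
  threshold (properColourings H (3 + L)) ≤ k′ →
  (p : Fin ((3 + L) * k′ * order H) → Fin (3 + L)) → G1Classes _ _ p →
  PerfectPacking H (multipartite _ _ p) ⇔ HcfOne H (3 + L)
χ≥3-equivalence H L χ@((c₀ , proper) , _) k′ k′≥1 t≤k′ p classes = mk⇔
  (λ packing → (λ _ → hcfχ≡1-of-packing H L k′ p classes packing) , λ ())
  (λ hcf → let (i₁ , i₂ , i₁≢i₂ , size₁ , size₂ , size) = G1-classSizes (2 + L) k′ (order H) p classes in
    packing-by-exchanges H (multipartite _ (3 + L) p) (properColourings H (3 + L))
      (proper-coprime H (2 + L) (proj₁ hcf λ ())) proper p (multipartite-realisable H p) k′ t≤k′ i₁≢i₂
      (nearlyBalanced p M≥1 i₁≢i₂ size₁ size₂ size))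
  where
  M≥1 : 1 ≤ k′ * order H
  M≥1 = *-mono-≤ k′≥1 (order≥1 H χ (s≤s (s≤s z≤n)))

χ≡2-equivalence : ∀ H → IsChromaticNumber H 2 → ∀ k′ → 1 ≤ k′ →
  threshold (properColourings H 2) ≤ k′ → threshold (componentColourings H) ≤ k′ →
  (p : Fin (2 * k′ * order H) → Fin 2) → G1Classes _ _ p → ∀ a → G2Order H (2 * k′ * order H) a →
  (PerfectPacking H (multipartite _ _ p) × PerfectPacking H (twoCliques _ a)) ⇔ HcfOne H 2
χ≡2-equivalence H χ@((c₀ , proper) , _) k′ k′≥1 t≤k′ t′≤k′ p classes a sizing@(_ , if-¬X) = mk⇔
  (λ (packing₁ , packing₂) → (λ 2≢2 → contradiction refl 2≢2) ,
    λ _ → hcfc≡1-of-packing H k′ M≥1 a sizing packing₂ ,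
          hcfχ≤2 H proper (D-divisors∣2-of-packing H k′ M≥1 p classes packing₁))
  (λ hcf → G1-packing (proj₁ (proj₂ hcf refl)) (proj₂ (proj₂ hcf refl)) , G2-packing (proj₁ (proj₂ hcf refl)))
  where
  N M : ℕ
  N = 2 * k′ * order H
  M = k′ * order H
  M≥1 : 1 ≤ M
  M≥1 = *-mono-≤ k′≥1 (order≥1 H χ (s≤s (s≤s z≤n)))
  G1-packing : HcfC H 1 → ∃[ g ] (HcfChi H 2 g × g ≤ 2) → PerfectPacking H (multipartite N 2 p)
  G1-packing hcf-c hcf-χ with G1-classSizes 1 k′ (order H) p classes
  ... | i₁ , i₂ , i₁≢i₂ , size₁ , size₂ , size =
    packing-by-exchanges H (multipartite N 2 p) (properColourings H 2) (bipartite-coprime H proper hcf-c hcf-χ) proper p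
      (multipartite-realisable H p) k′ t≤k′ i₁≢i₂ (nearlyBalanced p M≥1 i₁≢i₂ size₁ size₂ size)
  G2-packing : HcfC H 1 → PerfectPacking H (twoCliques N a)
  G2-packing hcf-c =
    packing-by-exchanges H (twoCliques N a) (componentColourings H) (component-coprime H hcf-c)
      {λ _ → zero} (λ _ _ _ → refl) (side {N} a) (twoCliques-realisable H a) k′ t′≤k′ {zero} {suc zero} (λ ())
      (nearlyBalanced (side {N} a) M≥1 (λ ()) (proj₁ sizes) (proj₂ sizes) only-two)
    where
    ¬X : ¬ (HcfC H 2 × ¬ (4 ∣ N))
    ¬X ((2-common , _) , _) = contradiction (proj₂ hcf-c 2 2-common) λ { (s≤s ()) }
    sizes : classSize (side {N} a) zero ≡ M + 1 × classSize (side {N} a) (suc zero) ≡ M ∸ 1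
    sizes = side-classSizes {N} (2*k*h≡M+M k′ (order H)) M≥1
              (trans (if-¬X ¬X) (cong (_+ 1) (⌊/⌋-ℓ* 1 k′ (order H))))
    only-two : ∀ (i : Fin 2) → i ≢ zero → i ≢ suc zero → classSize (side {N} a) i ≡ M
    only-two zero i≢0 = contradiction refl i≢0
    only-two (suc zero) _ i≢1 = contradiction refl i≢1

corollary8 : (H : Graph) (ℓ : ℕ) → IsChromaticNumber H ℓ → 2 ≤ ℓ →
    ∃[ k₀ ] ((k' : ℕ) → k₀ ≤ k' →
      ((3 ≤ ℓ → (p : Fin (ℓ * k' * order H) → Fin ℓ) →
          G1Classes (ℓ * k' * order H) ℓ p →
          (PerfectPacking H (multipartite (ℓ * k' * order H) ℓ p) ⇔ HcfOne H ℓ))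
      × (ℓ ≡ 2 → (p : Fin (ℓ * k' * order H) → Fin ℓ) →
          G1Classes (ℓ * k' * order H) ℓ p →
          (a : ℕ) → G2Order H (ℓ * k' * order H) a →
          ((PerfectPacking H (multipartite (ℓ * k' * order H) ℓ p)
            × PerfectPacking H (twoCliques (ℓ * k' * order H) a)) ⇔ HcfOne H ℓ))))
corollary8 H (suc (suc zero)) χ (s≤s (s≤s z≤n)) = suc (t₁ + t₂) , λ k′ k₀≤k′ →
  (λ { (s≤s (s≤s ())) }) ,
  λ _ → χ≡2-equivalence H χ k′ (≤-trans (s≤s z≤n) k₀≤k′)
          (≤-trans (m≤m+n t₁ t₂) (≤-trans (n≤1+n _) k₀≤k′))
          (≤-trans (m≤n+m t₂ t₁) (≤-trans (n≤1+n _) k₀≤k′))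
  where
  t₁ t₂ : ℕ
  t₁ = threshold (properColourings H 2)
  t₂ = threshold (componentColourings H)
corollary8 H (suc (suc (suc L))) χ (s≤s (s≤s z≤n)) = suc (threshold (properColourings H (3 + L))) , λ k′ k₀≤k′ →
  (λ _ → χ≥3-equivalence H L χ k′ (≤-trans (s≤s z≤n) k₀≤k′) (≤-trans (n≤1+n _) k₀≤k′)) , λ ()
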